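{- Let $n\ge 3$ and let $L:\{0,1,2,\dots,n\}\to\mathbb{N}$ be a function such that $L(0)=0$, $L(1)=0$, $L(2)=2$ and $L(3)=2$. Define the word $\Delta L$ of length $n-3$ whose $i$-th letter is $\Delta L(i)=L(i+3)-L(i+2)$ for $i=1,\dots,n-3$. Then there exists a caterpillar $C$ (with $n$ vertices) such that $L=L_C$ if and only if $\Delta L$ is a prefix normal word (in particular a word over $\{0,1\}$).
   Context: All graphs are finite, simple and undirected. For a graph $G$ with $n$ vertices, an induced subtree is an induced subgraph that is a tree (the empty graph and a single vertex count as trees); a leaf of a tree is a vertex of degree $1$. The leaf function $L_G:\{0,1,\dots,n\}\to\mathbb{N}\cup\{ -\infty\}$ is $L_G(i)=\max\{\text{number of leaves of }T : T \text{ an induced subtree of } G \text{ with } i \text{ vertices}\}$, with $\max\emptyset=-\infty$. A caterpillar is a tree $T$ such that the subgraph induced by the non-leaf vertices of $T$ is a path (the spine). A binary word $u$ over $\{0,1\}$ is prefix normal if for every prefix $p$ of $u$ and every factor (contiguous subword) $f$ of $u$ with $|p|=|f|$, the number of $1$'s in $p$ is at least the number of $1$'s in $f$. -}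

module Defs where

open import Data.Nat using (ℕ; zero; suc; _+_; _∸_; _≤_; _<?_; _≡ᵇ_)
open import Data.Bool using (Bool; true; false; _∧_; not)
open import Data.Fin using (Fin; toℕ; fromℕ<)
open import Data.Fin.Subset using (Subset; _∈_; ∣_∣; ⊤)
open import Data.Vec using (Vec; lookup; tabulate)
open import Data.List using (List; []; _∷_; _++_; length; map; upTo)
open import Data.List.Relation.Unary.All using (All)
open import Data.List.Relation.Unary.Unique.Propositional using (Unique)
open import Data.List.Relation.Unary.Linked using (Linked)
open import Data.Integer using (ℤ; +_; _-_)
open import Data.Product using (Σ; ∃; _×_; _,_)
open import Data.Sum using (_⊎_)
open import Relation.Nullary using (¬_; yes; no)
open import Relation.Binary.PropositionalEquality using (_≡_)
open import Function.Bundles using (_⇔_)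
open import Function.Definitions using (Injective)

record Graph (n : ℕ) : Set where
  field
    adj   : Fin n → Fin n → Bool
    sym   : ∀ u v → adj u v ≡ adj v u
    irref : ∀ u → adj u u ≡ false
open Graph public

module _ {n : ℕ} (G : Graph n) where

  Adj : Fin n → Fin n → Set
  Adj u v = adj G u v ≡ true

  data Walk (S : Subset n) : Fin n → Fin n → Set where
    here : ∀ {u} → u ∈ S → Walk S u u
    step : ∀ {u w v} → u ∈ S → Adj u w → Walk S w v → Walk S u v

  -- the subgraph induced by S is connected (empty graph counts as connected)
  Connected : Subset n → Set
  Connected S = ∀ u v → u ∈ S → v ∈ S → Walk S u v

  Cycle : Subset n → Set
  Cycle S = Σ (Fin n) λ v → Σ (List (Fin n)) λ ws →
    (2 ≤ length ws) × Unique (v ∷ ws) × All (_∈ S) (v ∷ ws)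
      × Linked Adj (v ∷ ws ++ v ∷ [])

  IsTree : Subset n → Set
  IsTree S = Connected S × ¬ Cycle S

  deg : Subset n → Fin n → ℕ
  deg S u = ∣ tabulate (λ v → lookup S v ∧ adj G u v) ∣

  leaves : Subset n → ℕ
  leaves S = ∣ tabulate (λ u → lookup S u ∧ (deg S u ≡ᵇ 1)) ∣

  LeafFunctionIs : ℕ → ℕ → Set
  LeafFunctionIs i k =
    (Σ (Subset n) λ S → ∣ S ∣ ≡ i × IsTree S × leaves S ≡ k)
    × (∀ S → ∣ S ∣ ≡ i → IsTree S → leaves S ≤ k)

  InducesPath : Subset n → Set
  InducesPath S = Σ ℕ λ k → Σ (Fin k → Fin n) λ f →
    Injective _≡_ _≡_ f
    × (∀ u → (u ∈ S) ⇔ (∃ λ i → f i ≡ u))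
    × (∀ i j → Adj (f i) (f j) ⇔ (suc (toℕ i) ≡ toℕ j ⊎ suc (toℕ j) ≡ toℕ i))

  nonLeaves : Subset n
  nonLeaves = tabulate (λ u → not (deg ⊤ u ≡ᵇ 1))

  IsCaterpillar : Set
  IsCaterpillar = IsTree ⊤ × InducesPath nonLeaves

-- value of L : {0..n} → ℕ at a natural number i (0 outside the range; only
-- used at i ≤ n)
at : ∀ {n} → (Fin (suc n) → ℕ) → ℕ → ℕ
at {n} L i with i <? suc n
... | yes p = L (fromℕ< p)
... | no _  = 0

-- ΔL as a list of integers: letter i (i = 1..n-3) is L(i+3) - L(i+2)
ΔL : ∀ n → (Fin (suc n) → ℕ) → List ℤ
ΔL n L = map (λ j → + at L (j + 4) - + at L (j + 3)) (upTo (n ∸ 3))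

ones : List Bool → ℕ
ones [] = 0
ones (true ∷ w) = suc (ones w)
ones (false ∷ w) = ones w

PrefixNormal : List Bool → Set
PrefixNormal u = ∀ p f → (∃ λ s → p ++ s ≡ u) → (∃ λ a → ∃ λ b → a ++ f ++ b ≡ u)
  → length p ≡ length f → ones f ≤ ones p

bitℤ : Bool → ℤ
bitℤ true = + 1
bitℤ false = + 0

IsPrefixNormalℤ : List ℤ → Set
IsPrefixNormalℤ x = Σ (List Bool) λ w → map bitℤ w ≡ x × PrefixNormal w

-- In a caterpillar with spine v₀ … v_(k-1) put e t = deg v_t - 1 ≥ 1. The internal vertices of an
-- induced subtree on i ≥ 3 vertices are m consecutive spine vertices and the subtree lies in their
-- closed neighbourhood, which has 2 + (sum of e over the window) vertices. So if μ i is the least m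
-- for which some window of m spine vertices has a closed neighbourhood of size ≥ i, then
-- L(i) = i - μ i, and this value is attained. Splitting a best window shows
-- μ (3 + a) + μ (3 + l) ≤ 1 + μ (3 + a + l), which is exactly prefix normality of the 0/1 word ΔL.
-- Conversely, a prefix normal word w gives the caterpillar whose spine vertex t has e t equal to
-- the number of positions of w preceded by exactly t zeros; prefix normality yields
-- μ (3 + j) = 1 + (number of zeros among the first j letters), hence L(3 + j) = 2 + (number of
-- ones among them), and ΔL spells w.

module Submission where

open import Defs hiding (sym; irref)
open import Data.Nat using (ℕ; suc; _+_; _≤_; _<_)
open import Data.Fin using (Fin; toℕ)
open import Data.Bool using (Bool)
open import Data.List using (List; length; map)
open import Data.Product using (Σ; _×_; _,_)
open import Data.Sum using (_⊎_)
open import Relation.Binary.PropositionalEquality using (_≡_)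
open import Function.Bundles using (_⇔_; mk⇔)

module Counting where

  open import Data.Nat using (ℕ; zero; suc; _+_; _∸_; _≤_; _<_; z≤n; s≤s; _≡ᵇ_; _≤ᵇ_; _<ᵇ_; _≤?_)
  open import Data.Nat.Properties
  import Data.Fin.Properties as FinP
  open import Data.Bool using (Bool; true; false; _∧_; _∨_; not; T)
  open import Data.Fin using (Fin; zero; suc; toℕ)
  open import Data.Fin.Subset using (Subset; _∈_; ∣_∣)
  open import Data.Vec using ([]; _∷_; lookup; tabulate)
  open import Data.Vec.Properties using ([]=⇒lookup; lookup⇒[]=; lookup∘tabulate)
  open import Data.Product using (∃; _×_; _,_)
  open import Data.Sum using (_⊎_; inj₁; inj₂)
  open import Data.Empty using (⊥-elim)
  open import Relation.Nullary using (¬_; yes; no)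
  open import Function using (_∘_)
  open import Relation.Binary.PropositionalEquality

  t≢f : true ≢ false
  t≢f ()

  ∧-l : ∀ {a b} → (a ∧ b) ≡ true → a ≡ true
  ∧-l {true} _ = refl

  ∧-r : ∀ {a b} → (a ∧ b) ≡ true → b ≡ true
  ∧-r {true} e = e

  ∧-i : ∀ {a b} → a ≡ true → b ≡ true → (a ∧ b) ≡ true
  ∧-i refl refl = refl

  ∨-l : ∀ {a b} → a ≡ true → (a ∨ b) ≡ true
  ∨-l refl = refl

  ∨-r : ∀ {a b} → b ≡ true → (a ∨ b) ≡ true
  ∨-r {true} _ = refl
  ∨-r {false} e = e

  ∨-e : ∀ {a b} → (a ∨ b) ≡ true → a ≡ true ⊎ b ≡ true
  ∨-e {true} _ = inj₁ refl
  ∨-e {false} e = inj₂ e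

  not-false : ∀ {a} → not a ≡ false → a ≡ true
  not-false {true} _ = refl

  not-true : ∀ {a} → not a ≡ true → a ≡ false
  not-true {false} _ = refl

  bool-ext : ∀ {a b} → (a ≡ true → b ≡ true) → (b ≡ true → a ≡ true) → a ≡ b
  bool-ext {true} {true} _ _ = refl
  bool-ext {true} {false} p _ = sym (p refl)
  bool-ext {false} {true} _ q = q refl
  bool-ext {false} {false} _ _ = refl

  ≡ᵇ-refl : ∀ m → (m ≡ᵇ m) ≡ true
  ≡ᵇ-refl zero = refl
  ≡ᵇ-refl (suc m) = ≡ᵇ-refl m

  ≡ᵇ-true⇒≡ : ∀ {m n} → (m ≡ᵇ n) ≡ true → m ≡ n
  ≡ᵇ-true⇒≡ {zero} {zero} _ = refl
  ≡ᵇ-true⇒≡ {suc m} {suc n} e = cong suc (≡ᵇ-true⇒≡ e)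

  ≢⇒≡ᵇ-false : ∀ {m n} → m ≢ n → (m ≡ᵇ n) ≡ false
  ≢⇒≡ᵇ-false {zero} {zero} ne = ⊥-elim (ne refl)
  ≢⇒≡ᵇ-false {zero} {suc n} _ = refl
  ≢⇒≡ᵇ-false {suc m} {zero} _ = refl
  ≢⇒≡ᵇ-false {suc m} {suc n} ne = ≢⇒≡ᵇ-false (ne ∘ cong suc)

  ≤ᵇ-true⇒≤ : ∀ {i j} → (i ≤ᵇ j) ≡ true → i ≤ j
  ≤ᵇ-true⇒≤ {i} {j} e = ≤ᵇ⇒≤ i j (subst T (sym e) _)

  ≤⇒≤ᵇ-true : ∀ {i j} → i ≤ j → (i ≤ᵇ j) ≡ true
  ≤⇒≤ᵇ-true {i} {j} p with i ≤ᵇ j | ≤⇒≤ᵇ p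
  ... | true | _ = refl

  ≤ᵇ-false⇒≰ : ∀ {i j} → (i ≤ᵇ j) ≡ false → ¬ i ≤ j
  ≤ᵇ-false⇒≰ e p = t≢f (trans (sym (≤⇒≤ᵇ-true p)) e)

  1≤d⇒d≢1⇒2≤d : ∀ {d} → 1 ≤ d → d ≢ 1 → 2 ≤ d
  1≤d⇒d≢1⇒2≤d {suc (suc d)} _ _ = s≤s (s≤s z≤n)
  1≤d⇒d≢1⇒2≤d {suc zero} _ d≢1 = ⊥-elim (d≢1 refl)

  _==_ : ∀ {n} → Fin n → Fin n → Bool
  x == y = toℕ x ≡ᵇ toℕ y

  ==-refl : ∀ {n} (x : Fin n) → (x == x) ≡ true
  ==-refl x = ≡ᵇ-refl (toℕ x)

  ==⇒≡ : ∀ {n} {x y : Fin n} → (x == y) ≡ true → x ≡ y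
  ==⇒≡ e = FinP.toℕ-injective (≡ᵇ-true⇒≡ e)

  bitValue : Bool → ℕ
  bitValue true = 1
  bitValue false = 0

  count : ∀ {n} → (Fin n → Bool) → ℕ
  count {zero} g = 0
  count {suc n} g = bitValue (g zero) + count (λ x → g (suc x))

  ∣tabulate∣≡count : ∀ {n} (g : Fin n → Bool) → ∣ tabulate g ∣ ≡ count g
  ∣tabulate∣≡count {zero} g = refl
  ∣tabulate∣≡count {suc n} g with g zero
  ... | true = cong suc (∣tabulate∣≡count (λ x → g (suc x)))
  ... | false = ∣tabulate∣≡count (λ x → g (suc x))

  ∣S∣≡count-lookup : ∀ {n} (S : Subset n) → ∣ S ∣ ≡ count (lookup S)
  ∣S∣≡count-lookup [] = refl
  ∣S∣≡count-lookup (true ∷ S) = cong suc (∣S∣≡count-lookup S)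
  ∣S∣≡count-lookup (false ∷ S) = ∣S∣≡count-lookup S

  ∈⇒lookup : ∀ {n} {S : Subset n} {x} → x ∈ S → lookup S x ≡ true
  ∈⇒lookup = []=⇒lookup

  lookup⇒∈ : ∀ {n} {S : Subset n} {x} → lookup S x ≡ true → x ∈ S
  lookup⇒∈ {S = S} {x} = lookup⇒[]= x S

  ∈-tabulate⁺ : ∀ {n} {c : Fin n → Bool} {x} → c x ≡ true → x ∈ tabulate c
  ∈-tabulate⁺ {c = c} {x} e = lookup⇒∈ (trans (lookup∘tabulate c x) e)

  ∈-tabulate⁻ : ∀ {n} {c : Fin n → Bool} {x} → x ∈ tabulate c → c x ≡ true
  ∈-tabulate⁻ {c = c} {x} m = trans (sym (lookup∘tabulate c x)) (∈⇒lookup m)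

  find : ∀ {n} (g : Fin n → Bool) → (∃ λ x → g x ≡ true) ⊎ (∀ x → g x ≡ false)
  find {zero} g = inj₂ (λ ())
  find {suc n} g with g zero in e
  ... | true = inj₁ (zero , e)
  ... | false with find (λ x → g (suc x))
  ... | inj₁ (x , p) = inj₁ (suc x , p)
  ... | inj₂ h = inj₂ λ { zero → e ; (suc x) → h x }

  count-cong : ∀ {n} {g h : Fin n → Bool} → (∀ x → g x ≡ h x) → count g ≡ count h
  count-cong {zero} _ = refl
  count-cong {suc n} e = cong₂ _+_ (cong bitValue (e zero)) (count-cong (λ x → e (suc x)))

  count-mono : ∀ {n} {g h : Fin n → Bool} → (∀ x → g x ≡ true → h x ≡ true) → count g ≤ count h
  count-mono {zero} _ = z≤n
  count-mono {suc n} {g} {h} e with g zero in eg | h zero in eh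
  ... | true | true = s≤s (count-mono (λ x → e (suc x)))
  ... | false | true = ≤-trans (n≤1+n _) (s≤s (count-mono (λ x → e (suc x))))
  ... | false | false = count-mono (λ x → e (suc x))
  ... | true | false with trans (sym eh) (e zero eg)
  ... | ()

  count-true : ∀ {n} → count {n} (λ _ → true) ≡ n
  count-true {zero} = refl
  count-true {suc n} = cong suc count-true

  count-false : ∀ {n} {g : Fin n → Bool} → (∀ x → g x ≡ false) → count g ≡ 0
  count-false {zero} _ = refl
  count-false {suc n} {g} e rewrite e zero = count-false (λ x → e (suc x))

  count-∨ : ∀ {n} (g h : Fin n → Bool) →
    count (λ x → g x ∨ h x) + count (λ x → g x ∧ h x) ≡ count g + count h
  count-∨ {zero} g h = refl
  count-∨ {suc n} g h with g zero | h zero | count-∨ (λ x → g (suc x)) (λ x → h (suc x))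
  ... | true | true | ih = cong suc (trans (+-suc _ _) (trans (cong suc ih) (sym (+-suc _ _))))
  ... | true | false | ih = cong suc ih
  ... | false | true | ih = trans (cong suc ih) (sym (+-suc _ _))
  ... | false | false | ih = ih

  count-∨-disjoint : ∀ {n} (g h : Fin n → Bool) → (∀ x → (g x ∧ h x) ≡ false) →
    count (λ x → g x ∨ h x) ≡ count g + count h
  count-∨-disjoint g h disj = begin
    count (λ x → g x ∨ h x)                           ≡⟨ sym (+-identityʳ _) ⟩
    count (λ x → g x ∨ h x) + 0                       ≡⟨ cong (count (λ x → g x ∨ h x) +_) (sym (count-false disj)) ⟩
    count (λ x → g x ∨ h x) + count (λ x → g x ∧ h x) ≡⟨ count-∨ g h ⟩
    count g + count h                                 ∎
    where open ≡-Reasoning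

  count-split : ∀ {n} (g h : Fin n → Bool) →
    count g ≡ count (λ x → g x ∧ h x) + count (λ x → g x ∧ not (h x))
  count-split {zero} g h = refl
  count-split {suc n} g h with g zero | h zero | count-split (λ x → g (suc x)) (λ x → h (suc x))
  ... | true | true | ih = cong suc ih
  ... | true | false | ih = trans (cong suc ih) (sym (+-suc _ _))
  ... | false | true | ih = ih
  ... | false | false | ih = ih

  count-pos : ∀ {n} {g : Fin n → Bool} x → g x ≡ true → 1 ≤ count g
  count-pos {suc n} {g} zero e rewrite e = s≤s z≤n
  count-pos {suc n} {g} (suc x) e = ≤-trans (count-pos {g = λ y → g (suc y)} x e) (m≤n+m _ _)

  count-== : ∀ {n} (x : Fin n) → count (λ z → z == x) ≡ 1
  count-== {suc n} zero = cong suc (count-false {n} {g = λ y → suc y == zero} λ _ → refl)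
  count-== {suc n} (suc x) = count-== x

  count-pair : ∀ {n} (x y : Fin n) → x ≢ y → count (λ v → (v == x) ∨ (v == y)) ≡ 2
  count-pair x y x≢y =
    trans (count-∨-disjoint (_== x) (_== y) disjoint) (cong₂ _+_ (count-== x) (count-== y))
    where
    disjoint : ∀ z → ((z == x) ∧ (z == y)) ≡ false
    disjoint z with z == x in e₁ | z == y in e₂
    ... | true | true = ⊥-elim (x≢y (trans (sym (==⇒≡ {x = z} e₁)) (==⇒≡ {x = z} e₂)))
    ... | true | false = refl
    ... | false | _ = refl

  count≤1 : ∀ {n} {g : Fin n → Bool} x → (∀ z → g z ≡ true → z ≡ x) → count g ≤ 1
  count≤1 {g = g} x e = ≤-trans (count-mono {h = _== x} onlyX) (≤-reflexive (count-== x))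
    where
    onlyX : ∀ z → g z ≡ true → (z == x) ≡ true
    onlyX z gz = subst (λ w → (w == x) ≡ true) (sym (e z gz)) (==-refl x)

  count≤2 : ∀ {n} {g : Fin n → Bool} x y → (∀ z → g z ≡ true → z ≡ x ⊎ z ≡ y) → count g ≤ 2
  count≤2 {g = g} x y e = ≤-trans (count-mono {h = λ z → (z == x) ∨ (z == y)} onlyXY)
    (≤-trans (m≤m+n _ _) (≤-reflexive (trans (count-∨ (_== x) (_== y)) (cong₂ _+_ (count-== x) (count-== y)))))
    where
    onlyXY : ∀ z → g z ≡ true → ((z == x) ∨ (z == y)) ≡ true
    onlyXY z gz with e z gz
    ... | inj₁ refl = ∨-l (==-refl z)
    ... | inj₂ refl = ∨-r {z == x} (==-refl z)

  2≤count : ∀ {n} {g : Fin n → Bool} x y → g x ≡ true → g y ≡ true → x ≢ y → 2 ≤ count g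
  2≤count {g = g} x y gx gy x≢y =
    ≤-trans (≤-reflexive (sym (count-pair x y x≢y))) (count-mono onXY)
    where
    onXY : ∀ z → ((z == x) ∨ (z == y)) ≡ true → g z ≡ true
    onXY z hz with ∨-e {z == x} hz
    ... | inj₁ e = subst (λ w → g w ≡ true) (sym (==⇒≡ {x = z} e)) gx
    ... | inj₂ e = subst (λ w → g w ≡ true) (sym (==⇒≡ {x = z} e)) gy

  exists-other : ∀ {n} (g : Fin n → Bool) u → 2 ≤ count g → ∃ λ z → g z ≡ true × z ≢ u
  exists-other g u p with find (λ z → g z ∧ not (z == u))
  ... | inj₁ (z , e) = z , ∧-l e , λ { refl → t≢f (trans (sym (∧-r {g z} e)) (cong not (==-refl z))) }
  ... | inj₂ none = ⊥-elim (1+n≰n (≤-trans p (count≤1 u onlyU)))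
    where
    onlyU : ∀ z → g z ≡ true → z ≡ u
    onlyU z gz with z == u in e
    ... | true = ==⇒≡ {x = z} e
    ... | false = ⊥-elim (t≢f (trans (sym (∧-i gz (cong not e))) (none z)))

  exists-other₂ : ∀ {n} (g : Fin n → Bool) u x → 3 ≤ count g → ∃ λ z → g z ≡ true × z ≢ u × z ≢ x
  exists-other₂ g u x p with find (λ z → g z ∧ (not (z == u) ∧ not (z == x)))
  ... | inj₁ (z , e) = z , ∧-l e
      , (λ { refl → t≢f (trans (sym (∧-l (∧-r {g z} e))) (cong not (==-refl z))) })
      , (λ { refl → t≢f (trans (sym (∧-r {not (z == u)} (∧-r {g z} e))) (cong not (==-refl z))) })
  ... | inj₂ none = ⊥-elim (1+n≰n (≤-trans p (count≤2 u x onlyUX)))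
    where
    onlyUX : ∀ z → g z ≡ true → z ≡ u ⊎ z ≡ x
    onlyUX z gz with z == u in e₁ | z == x in e₂
    ... | true | _ = inj₁ (==⇒≡ {x = z} e₁)
    ... | false | true = inj₂ (==⇒≡ {x = z} e₂)
    ... | false | false = ⊥-elim (t≢f (trans (sym (∧-i gz (∧-i (cong not e₁) (cong not e₂)))) (none z)))

  module Extend {n} (a b : Fin (suc n) → Bool) where
    extend : ∀ {i} (γ : Bool) → (a zero ≡ true → γ ≡ true) → (γ ≡ true → b zero ≡ true) →
      (∃ λ c → (∀ x → a (suc x) ≡ true → c x ≡ true) × (∀ x → c x ≡ true → b (suc x) ≡ true) × count c ≡ i) →
      ∃ λ c → (∀ x → a x ≡ true → c x ≡ true) × (∀ x → c x ≡ true → b x ≡ true) × count c ≡ bitValue γ + i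
    extend γ a₀ b₀ (c , ac , cb , ec) = c′ , ac′ , cb′ , cong (bitValue γ +_) ec
      where
      c′ : Fin (suc n) → Bool
      c′ zero = γ
      c′ (suc x) = c x
      ac′ : ∀ x → a x ≡ true → c′ x ≡ true
      ac′ zero = a₀
      ac′ (suc x) = ac x
      cb′ : ∀ x → c′ x ≡ true → b x ≡ true
      cb′ zero = b₀
      cb′ (suc x) = cb x

  choose-between : ∀ {n} (a b : Fin n → Bool) (i : ℕ) → (∀ x → a x ≡ true → b x ≡ true) →
    count a ≤ i → i ≤ count b →
    ∃ λ c → (∀ x → a x ≡ true → c x ≡ true) × (∀ x → c x ≡ true → b x ≡ true) × count c ≡ i
  choose-between {zero} a b zero _ _ _ = (λ _ → false) , (λ ()) , (λ ()) , refl
  choose-between {suc n} a b i a⊆b p q with a zero in ea | b zero in eb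
  ... | true | false with trans (sym eb) (a⊆b zero ea)
  ... | ()
  choose-between {suc n} a b (suc i) a⊆b (s≤s p) (s≤s q) | true | true =
    extend true (λ _ → refl) (λ _ → eb) (choose-between _ _ i (λ x → a⊆b (suc x)) p q)
    where open Extend a b
  choose-between {suc n} a b i a⊆b p q | false | false =
    extend false (λ e → ⊥-elim (t≢f (trans (sym e) ea))) (λ ()) (choose-between _ _ i (λ x → a⊆b (suc x)) p q)
    where open Extend a b
  choose-between {suc n} a b i a⊆b p q | false | true with i ≤? count (λ x → b (suc x))
  ... | yes i≤ = extend false (λ e → ⊥-elim (t≢f (trans (sym e) ea))) (λ ()) (choose-between _ _ i (λ x → a⊆b (suc x)) p i≤)
    where open Extend a b
  choose-between {suc n} a b zero a⊆b p q | false | true | no i≰ = ⊥-elim (i≰ z≤n)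
  choose-between {suc n} a b (suc i) a⊆b p (s≤s q) | false | true | no i≰ =
    extend true (λ _ → refl) (λ _ → eb)
      (choose-between _ _ i (λ x → a⊆b (suc x)) (≤-trans (count-mono (λ x → a⊆b (suc x))) (≤-pred (≰⇒> i≰))) q)
    where open Extend a b

  countℕ : (ℕ → Bool) → ℕ → ℕ
  countℕ P zero = 0
  countℕ P (suc m) = bitValue (P 0) + countℕ (λ y → P (suc y)) m

  count-toℕ : ∀ {n} (P : ℕ → Bool) → count {n} (λ x → P (toℕ x)) ≡ countℕ P n
  count-toℕ {zero} P = refl
  count-toℕ {suc n} P = cong (bitValue (P 0) +_) (count-toℕ {n} (λ y → P (suc y)))

  countℕ-cong : ∀ (P Q : ℕ → Bool) M → (∀ y → y < M → P y ≡ Q y) → countℕ P M ≡ countℕ Q M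
  countℕ-cong P Q zero h = refl
  countℕ-cong P Q (suc M) h = cong₂ _+_ (cong bitValue (h 0 (s≤s z≤n)))
    (countℕ-cong (λ y → P (suc y)) (λ y → Q (suc y)) M (λ y p → h (suc y) (s≤s p)))

  countℕ-false : ∀ (P : ℕ → Bool) M → (∀ y → y < M → P y ≡ false) → countℕ P M ≡ 0
  countℕ-false P zero h = refl
  countℕ-false P (suc M) h rewrite h 0 (s≤s z≤n) = countℕ-false (λ y → P (suc y)) M (λ y p → h (suc y) (s≤s p))

  countℕ-∨-disjoint : ∀ (P Q : ℕ → Bool) M → (∀ y → y < M → (P y ∧ Q y) ≡ false) →
    countℕ (λ y → P y ∨ Q y) M ≡ countℕ P M + countℕ Q M
  countℕ-∨-disjoint P Q zero h = refl
  countℕ-∨-disjoint P Q (suc M) h with P 0 | Q 0 | h 0 (s≤s z≤n)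
    | countℕ-∨-disjoint (λ y → P (suc y)) (λ y → Q (suc y)) M (λ y p → h (suc y) (s≤s p))
  ... | true | true | () | _
  ... | true | false | _ | ih = cong suc ih
  ... | false | true | _ | ih = trans (cong suc ih) (sym (+-suc _ _))
  ... | false | false | _ | ih = ih

  countℕ-≡ᵇ : ∀ x M → x < M → countℕ (x ≡ᵇ_) M ≡ 1
  countℕ-≡ᵇ zero (suc M) _ = cong suc (countℕ-false _ M (λ _ _ → refl))
  countℕ-≡ᵇ (suc x) (suc M) (s≤s p) = countℕ-≡ᵇ x M p

  countℕ-interval : ∀ a b M → a ≤ b → b ≤ M → countℕ (λ y → (a ≤ᵇ y) ∧ (y <ᵇ b)) M ≡ b ∸ a
  countℕ-interval zero zero M _ _ = countℕ-false _ M (λ _ _ → refl)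
  countℕ-interval zero (suc b) (suc M) _ (s≤s q) = cong suc (countℕ-interval zero b M z≤n q)
  countℕ-interval (suc a) (suc b) (suc M) (s≤s p) (s≤s q) =
    trans (countℕ-cong _ _ M (λ y _ → cong (_∧ (y <ᵇ b)) (<ᵇ-suc a y))) (countℕ-interval a b M p q)
    where
    <ᵇ-suc : ∀ a y → (a <ᵇ suc y) ≡ (a ≤ᵇ y)
    <ᵇ-suc zero y = refl
    <ᵇ-suc (suc a) y = refl

module InducedSubgraphs {n : ℕ} (G : Graph n) where

  open Counting
  open import Data.Nat using (ℕ; _+_; _≤_; _≡ᵇ_)
  open import Data.Nat.Properties hiding (_≟_)
  open import Data.Bool using (Bool; true; false; _∧_; _∨_; not)
  open import Data.Fin using (Fin; _≟_)
  open import Data.Fin.Subset using (Subset; _∈_; ∣_∣; ⊤)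
  open import Data.Vec using (lookup; tabulate)
  open import Data.Vec.Properties using (lookup-replicate)
  open import Data.List.Relation.Unary.All as All using ()
  open import Data.Product using (∃; _×_; _,_)
  open import Data.Sum using (_⊎_; inj₁; inj₂)
  open import Data.Empty using (⊥-elim)
  open import Relation.Nullary using (¬_; yes; no)
  open import Relation.Binary.PropositionalEquality

  adjIn : Subset n → Fin n → Fin n → Bool
  adjIn S u v = lookup S v ∧ adj G u v

  isLeaf : Subset n → Fin n → Bool
  isLeaf S u = lookup S u ∧ (deg G S u ≡ᵇ 1)

  internal : Subset n → Fin n → Bool
  internal S u = lookup S u ∧ not (deg G S u ≡ᵇ 1)

  deg≡count : ∀ S u → deg G S u ≡ count (adjIn S u)
  deg≡count S u = ∣tabulate∣≡count (adjIn S u)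

  leaves≡count : ∀ S → leaves G S ≡ count (isLeaf S)
  leaves≡count S = ∣tabulate∣≡count (isLeaf S)

  ∣S∣≡leaves+internal : ∀ S → ∣ S ∣ ≡ leaves G S + count (internal S)
  ∣S∣≡leaves+internal S =
    trans (∣S∣≡count-lookup S) (trans (count-split (lookup S) (λ u → deg G S u ≡ᵇ 1))
      (cong (_+ count (internal S)) (sym (leaves≡count S))))

  leaves≤∣S∣ : ∀ S → leaves G S ≤ ∣ S ∣
  leaves≤∣S∣ S = ≤-trans (m≤m+n _ _) (≤-reflexive (sym (∣S∣≡leaves+internal S)))

  adj-sym : ∀ {u v} → Adj G u v → Adj G v u
  adj-sym {u} {v} e = trans (sym (Graph.sym G u v)) e

  adj-irrefl : ∀ {u} → ¬ Adj G u u
  adj-irrefl {u} e = t≢f (trans (sym e) (Graph.irref G u))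

  adj⇒≢ : ∀ {u v} → Adj G u v → u ≢ v
  adj⇒≢ a refl = adj-irrefl a

  deg≡1⇒neighbour-unique : ∀ S u {v v′} → deg G S u ≡ 1 →
    v ∈ S → Adj G u v → v′ ∈ S → Adj G u v′ → v ≡ v′
  deg≡1⇒neighbour-unique S u {v} {v′} d m a m′ a′ with v ≟ v′
  ... | yes p = p
  ... | no v≢v′ = ⊥-elim (1+n≰n (≤-trans
        (2≤count {g = adjIn S u} v v′ (∧-i (∈⇒lookup m) a) (∧-i (∈⇒lookup m′) a′) v≢v′)
        (≤-reflexive (trans (sym (deg≡count S u)) d))))

  deg-pos : ∀ S u v → v ∈ S → Adj G u v → 1 ≤ deg G S u
  deg-pos S u v m a = ≤-trans (count-pos {g = adjIn S u} v (∧-i (∈⇒lookup m) a)) (≤-reflexive (sym (deg≡count S u)))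

  deg-mono : ∀ S T u → (∀ x → lookup S x ≡ true → lookup T x ≡ true) → deg G S u ≤ deg G T u
  deg-mono S T u h = subst₂ _≤_ (sym (deg≡count S u)) (sym (deg≡count T u))
    (count-mono (λ x e → ∧-i (h x (∧-l e)) (∧-r e)))

  deg≤1 : ∀ S u x → (∀ v → v ∈ S → Adj G u v → v ≡ x) → deg G S u ≤ 1
  deg≤1 S u x h = ≤-trans (≤-reflexive (deg≡count S u)) (count≤1 x (λ v e → h v (lookup⇒∈ (∧-l e)) (∧-r e)))

  ¬internal⇒deg≡1 : ∀ S u → u ∈ S → internal S u ≡ false → deg G S u ≡ 1
  ¬internal⇒deg≡1 S u m e = ≡ᵇ-true⇒≡ (not-false (∧-false-left (∈⇒lookup m) e))
    where
    ∧-false-left : ∀ {a b} → a ≡ true → (a ∧ b) ≡ false → b ≡ false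
    ∧-false-left refl e = e

  walk-source∈ : ∀ {S u v} → Walk G S u v → u ∈ S
  walk-source∈ (here m) = m
  walk-source∈ (step m _ _) = m

  walk-target∈ : ∀ {S u v} → Walk G S u v → v ∈ S
  walk-target∈ (here m) = m
  walk-target∈ (step _ _ w) = walk-target∈ w

  walk-append : ∀ {S u v w} → Walk G S u v → Walk G S v w → Walk G S u w
  walk-append (here _) q = q
  walk-append (step m a p) q = step m a (walk-append p q)

  walk-snoc : ∀ {S u v w} → Walk G S u v → Adj G v w → w ∈ S → Walk G S u w
  walk-snoc p a m = walk-append p (step (walk-target∈ p) a (here m))

  walk-reverse : ∀ {S u v} → Walk G S u v → Walk G S v u
  walk-reverse (here m) = here m
  walk-reverse (step m a p) = walk-snoc (walk-reverse p) (adj-sym a) m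

  walk-first-step : ∀ {S u v} → Walk G S u v → u ≢ v → ∃ λ w → w ∈ S × Adj G u w
  walk-first-step (here _) u≢v = ⊥-elim (u≢v refl)
  walk-first-step (step _ a p) _ = _ , walk-source∈ p , a

  walk-from-leaf-edge : ∀ S u x → u ∈ S → x ∈ S → Adj G u x → deg G S u ≡ 1 → deg G S x ≡ 1 →
    ∀ {y z} → (y ≡ u ⊎ y ≡ x) → Walk G S y z → z ≡ u ⊎ z ≡ x
  walk-from-leaf-edge S u x mu mx a du dx y∈ (here _) = y∈
  walk-from-leaf-edge S u x mu mx a du dx (inj₁ refl) (step _ a′ p)
    with deg≡1⇒neighbour-unique S u du (walk-source∈ p) a′ mx a
  ... | refl = walk-from-leaf-edge S u x mu mx a du dx (inj₂ refl) p
  walk-from-leaf-edge S u x mu mx a du dx (inj₂ refl) (step _ a′ p)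
    with deg≡1⇒neighbour-unique S x dx (walk-source∈ p) a′ mu (adj-sym a)
  ... | refl = walk-from-leaf-edge S u x mu mx a du dx (inj₁ refl) p

  leaf-neighbour-not-leaf : ∀ S → Connected G S → 3 ≤ ∣ S ∣ → ∀ u x → u ∈ S → x ∈ S → Adj G u x →
    deg G S u ≡ 1 → deg G S x ≢ 1
  leaf-neighbour-not-leaf S c s3 u x mu mx a du dx
    with exists-other₂ (lookup S) u x (subst (3 ≤_) (∣S∣≡count-lookup S) s3)
  ... | z , mz , z≢u , z≢x with walk-from-leaf-edge S u x mu mx a du dx (inj₁ refl) (c u z mu (lookup⇒∈ mz))
  ... | inj₁ e = z≢u e
  ... | inj₂ e = z≢x e

  has-neighbour : ∀ S → Connected G S → 2 ≤ ∣ S ∣ → ∀ u → u ∈ S → ∃ λ w → w ∈ S × Adj G u w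
  has-neighbour S c s2 u mu with exists-other (lookup S) u (subst (2 ≤_) (∣S∣≡count-lookup S) s2)
  ... | z , mz , z≢u = walk-first-step (c u z mu (lookup⇒∈ mz)) (λ e → z≢u (sym e))

  internal⇒2≤deg : ∀ S → Connected G S → 2 ≤ ∣ S ∣ → ∀ u → internal S u ≡ true → 2 ≤ deg G S u
  internal⇒2≤deg S c s2 u e with has-neighbour S c s2 u (lookup⇒∈ (∧-l e))
  ... | w , mw , a = 1≤d⇒d≢1⇒2≤d (deg-pos S u w mw a) (λ d1 →
        t≢f (trans (sym (≡ᵇ-refl 1)) (trans (cong (_≡ᵇ 1) (sym d1)) (not-true (∧-r {lookup S u} e)))))

  -- A walk between internal vertices never needs to visit a leaf: a leaf is a dead end.
  walk-internal : ∀ S {a b} → internal S a ≡ true → internal S b ≡ true →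
    Walk G S a b → Walk G (tabulate (internal S)) a b
  walk-internal S ia ib (here _) = here (∈-tabulate⁺ ia)
  walk-internal S ia ib (step {w = w} m adj p) with internal S w in iw
  ... | true = step (∈-tabulate⁺ ia) adj (walk-internal S iw ib p)
  walk-internal S ia ib (step m adj (here _)) | false = ⊥-elim (t≢f (trans (sym ib) iw))
  walk-internal S ia ib (step {w = w} m adj (step m′ adj′ p)) | false
    with deg≡1⇒neighbour-unique S w (¬internal⇒deg≡1 S w m′ iw) (walk-source∈ p) adj′ m (adj-sym adj)
  ... | refl = walk-internal S ia ib p

  ∅-connected : Connected G (tabulate (λ _ → false))
  ∅-connected u _ u∈ _ = ⊥-elim (t≢f (sym (∈-tabulate⁻ {c = λ _ → false} u∈)))

  ∣∅∣≡0 : ∣ tabulate {n = n} (λ _ → false) ∣ ≡ 0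
  ∣∅∣≡0 = trans (∣tabulate∣≡count {n} (λ _ → false)) (count-false {n} (λ _ → refl))

  singleton : Fin n → Subset n
  singleton x = tabulate (_== x)

  ∣singleton∣≡1 : ∀ x → ∣ (singleton x) ∣ ≡ 1
  ∣singleton∣≡1 x = trans (∣tabulate∣≡count (_== x)) (count-== x)

  singleton-connected : ∀ x → Connected G (singleton x)
  singleton-connected x u v u∈ v∈ with ==⇒≡ {x = u} (∈-tabulate⁻ u∈) | ==⇒≡ {x = v} (∈-tabulate⁻ v∈)
  ... | refl | refl = here u∈

  leaves-∣S∣≡1 : ∀ S → ∣ S ∣ ≡ 1 → leaves G S ≡ 0
  leaves-∣S∣≡1 S ∣S∣≡1 = trans (leaves≡count S) (count-false notLeaf)
    where
    notLeaf : ∀ u → isLeaf S u ≡ false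
    notLeaf u with lookup S u in u∈ | deg G S u ≡ᵇ 1 in d
    ... | false | _ = refl
    ... | true | false = refl
    ... | true | true with find (adjIn S u)
    ... | inj₂ none = ⊥-elim (0≢1+n (trans (sym (count-false none)) (trans (sym (deg≡count S u)) (≡ᵇ-true⇒≡ d))))
    ... | inj₁ (v , v∈) = ⊥-elim (1+n≰n (≤-trans (2≤count {g = lookup S} u v u∈ (∧-l v∈) (λ u≡v → adj⇒≢ (∧-r {lookup S v} v∈) u≡v))
                            (≤-reflexive (trans (sym (∣S∣≡count-lookup S)) ∣S∣≡1))))

  pair : Fin n → Fin n → Subset n
  pair x y = tabulate (λ v → (v == x) ∨ (v == y))

  ∈pair : ∀ {x y u} → u ∈ (pair x y) → u ≡ x ⊎ u ≡ y
  ∈pair {x} {y} {u} u∈ with ∨-e {u == x} (∈-tabulate⁻ {c = λ v → (v == x) ∨ (v == y)} u∈)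
  ... | inj₁ q = inj₁ (==⇒≡ {x = u} q)
  ... | inj₂ q = inj₂ (==⇒≡ {x = u} q)

  module Edge {x y : Fin n} (x~y : Adj G x y) where

    x∈ : x ∈ (pair x y)
    x∈ = ∈-tabulate⁺ (∨-l (==-refl x))

    y∈ : y ∈ (pair x y)
    y∈ = ∈-tabulate⁺ (∨-r {y == x} (==-refl y))

    ∣pair∣≡2 : ∣ (pair x y) ∣ ≡ 2
    ∣pair∣≡2 = trans (∣tabulate∣≡count (λ v → (v == x) ∨ (v == y))) (count-pair x y (adj⇒≢ x~y))

    pair-connected : Connected G (pair x y)
    pair-connected u v u∈ v∈ = walk (∈pair u∈) (∈pair v∈) u∈ v∈
      where
      walk : ∀ {u v} → u ≡ x ⊎ u ≡ y → v ≡ x ⊎ v ≡ y → u ∈ (pair x y) → v ∈ (pair x y) → Walk G (pair x y) u v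
      walk (inj₁ refl) (inj₁ refl) u∈ _ = here u∈
      walk (inj₂ refl) (inj₂ refl) u∈ _ = here u∈
      walk (inj₁ refl) (inj₂ refl) u∈ v∈ = step u∈ x~y (here v∈)
      walk (inj₂ refl) (inj₁ refl) u∈ v∈ = step u∈ (adj-sym x~y) (here v∈)

    deg-end≡1 : ∀ {u w} → u ∈ (pair x y) → w ∈ (pair x y) → Adj G u w → deg G (pair x y) u ≡ 1
    deg-end≡1 {u} {w} u∈ w∈ u~w = ≤-antisym (deg≤1 (pair x y) u w onlyW) (deg-pos (pair x y) u w w∈ u~w)
      where
      other : ∀ {v} → v ∈ (pair x y) → u ≢ v → ∀ {v′} → v′ ∈ (pair x y) → u ≢ v′ → v ≡ v′
      other v∈ u≢v v′∈ u≢v′ with ∈pair u∈ | ∈pair v∈ | ∈pair v′∈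
      ... | inj₁ refl | inj₁ refl | _ = ⊥-elim (u≢v refl)
      ... | inj₂ refl | inj₂ refl | _ = ⊥-elim (u≢v refl)
      ... | _ | _ | inj₁ refl with ∈pair u∈ | ∈pair v∈
      ...   | _ | inj₁ refl = refl
      ...   | inj₁ refl | inj₂ refl = ⊥-elim (u≢v′ refl)
      ...   | inj₂ refl | inj₂ refl = ⊥-elim (u≢v refl)
      other v∈ u≢v v′∈ u≢v′ | _ | _ | inj₂ refl with ∈pair u∈ | ∈pair v∈
      ...   | _ | inj₂ refl = refl
      ...   | inj₂ refl | inj₁ refl = ⊥-elim (u≢v′ refl)
      ...   | inj₁ refl | inj₁ refl = ⊥-elim (u≢v refl)
      onlyW : ∀ v → v ∈ (pair x y) → Adj G u v → v ≡ w
      onlyW v v∈ u~v = other v∈ (adj⇒≢ u~v) w∈ (adj⇒≢ u~w)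

    leaves-pair : leaves G (pair x y) ≡ 2
    leaves-pair = ≤-antisym (≤-trans (leaves≤∣S∣ (pair x y)) (≤-reflexive ∣pair∣≡2))
      (≤-trans (2≤count {g = isLeaf (pair x y)} x y
                 (∧-i (∈⇒lookup x∈) (cong (_≡ᵇ 1) (deg-end≡1 x∈ y∈ x~y)))
                 (∧-i (∈⇒lookup y∈) (cong (_≡ᵇ 1) (deg-end≡1 y∈ x∈ (adj-sym x~y))))
                 (adj⇒≢ x~y))
        (≤-reflexive (sym (leaves≡count (pair x y)))))

  acyclic-subset : ∀ S → ¬ Cycle G ⊤ → ¬ Cycle G S
  acyclic-subset S acyclic (v , ws , l , u , al , lk) =
    acyclic (v , ws , l , u , All.map (λ {x} _ → lookup⇒∈ (lookup-replicate x true)) al , lk)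

module Search where

  open import Data.Nat using (zero; suc; z≤n; s≤s; _≤?_)
  open import Data.Nat.Properties
  open import Data.Bool using (Bool; true; false)
  open import Relation.Nullary using (yes; no)
  open import Relation.Binary.PropositionalEquality

  -- the least j < b with P j, or b if there is none
  search : (ℕ → Bool) → ℕ → ℕ
  search P zero = 0
  search P (suc b) with P 0
  ... | true = 0
  ... | false = suc (search (λ j → P (suc j)) b)

  search≤ : ∀ P b → search P b ≤ b
  search≤ P zero = z≤n
  search≤ P (suc b) with P 0
  ... | true = z≤n
  ... | false = s≤s (search≤ _ b)

  search-minimal : ∀ P b j → j < search P b → P j ≡ false
  search-minimal P (suc b) j lt with P 0 in e
  search-minimal P (suc b) zero lt | false = e
  search-minimal P (suc b) (suc j) (s≤s lt) | false = search-minimal (λ j → P (suc j)) b j lt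

  search-found : ∀ P b → search P b < b → P (search P b) ≡ true
  search-found P (suc b) lt with P 0 in e
  ... | true = e
  ... | false = search-found (λ j → P (suc j)) b (≤-pred lt)

  1≤search : ∀ P b → 0 < b → P 0 ≡ false → 1 ≤ search P b
  1≤search P (suc b) _ P0 with P 0 | P0
  ... | false | _ = s≤s z≤n

  search-least : ∀ P b j → P j ≡ true → search P b ≤ j
  search-least P b j pj with search P b ≤? j
  ... | yes p = p
  ... | no np with trans (sym pj) (search-minimal P b j (≰⇒> np))
  ... | ()

module WindowSums where

  open Counting
  open Search
  open import Data.Nat using (zero; suc; _+_; _∸_; z≤n; s≤s; _⊔_; _≤ᵇ_; _≤?_)
  open import Data.Nat.Properties
  open import Data.Product using (∃; _×_; _,_)
  open import Data.Sum using (_⊎_; inj₁; inj₂)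
  open import Data.Empty using (⊥-elim)
  open import Relation.Nullary using (¬_; yes; no)
  open import Relation.Binary.PropositionalEquality
  open import Data.Nat.Tactic.RingSolver using (solve-∀)

  windowSum : (ℕ → ℕ) → ℕ → ℕ → ℕ
  windowSum e s zero = 0
  windowSum e s (suc m) = e s + windowSum e (suc s) m

  windowSum-+ : ∀ e s p q → windowSum e s (p + q) ≡ windowSum e s p + windowSum e (s + p) q
  windowSum-+ e s zero q = cong (λ x → windowSum e x q) (sym (+-identityʳ s))
  windowSum-+ e s (suc p) q = trans
    (cong (e s +_) (trans (windowSum-+ e (suc s) p q) (cong (λ x → windowSum e (suc s) p + windowSum e x q) (sym (+-suc s p)))))
    (sym (+-assoc (e s) _ _))

  windowSum-snoc : ∀ e s m → windowSum e s (suc m) ≡ windowSum e s m + e (s + m)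
  windowSum-snoc e s m = trans (cong (windowSum e s) (+-comm 1 m))
    (trans (windowSum-+ e s m 1) (cong (windowSum e s m +_) (+-identityʳ _)))

  -- e t plays the role of deg v_t - 1 along a spine v₀ … v_(k-1), so that 2 + windowSum e s m is the
  -- size of the closed neighbourhood of v_s … v_(s+m-1) and capacity m the largest such size.
  module Profile (k : ℕ) (1≤k : 1 ≤ k) (e : ℕ → ℕ) (1≤e : ∀ t → t < k → 1 ≤ e t)
                 (n : ℕ) (n≤2+Σe : n ≤ 2 + windowSum e 0 k) where

    m≤windowSum : ∀ s m → s + m ≤ k → m ≤ windowSum e s m
    m≤windowSum s zero _ = z≤n
    m≤windowSum s (suc m) p = +-mono-≤ (1≤e s (≤-trans (s≤s (m≤m+n s m)) p′)) (m≤windowSum (suc s) m p′)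
      where
      p′ : suc s + m ≤ k
      p′ = ≤-trans (≤-reflexive (sym (+-suc s m))) p

    maxWindow : ℕ → ℕ → ℕ
    maxWindow m zero = windowSum e 0 m
    maxWindow m (suc r) = maxWindow m r ⊔ windowSum e (suc r) m

    windowSum≤maxWindow : ∀ m r s → s ≤ r → windowSum e s m ≤ maxWindow m r
    windowSum≤maxWindow m zero zero _ = ≤-refl
    windowSum≤maxWindow m (suc r) s p with m≤n⇒m<n∨m≡n p
    ... | inj₁ lt = ≤-trans (windowSum≤maxWindow m r s (≤-pred lt)) (m≤m⊔n _ _)
    ... | inj₂ refl = m≤n⊔m _ _

    maxWindow-attained : ∀ m r → ∃ λ s → s ≤ r × maxWindow m r ≡ windowSum e s m
    maxWindow-attained m zero = 0 , z≤n , refl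
    maxWindow-attained m (suc r) with ⊔-sel (maxWindow m r) (windowSum e (suc r) m)
    ... | inj₂ q = suc r , ≤-refl , q
    ... | inj₁ q with maxWindow-attained m r
    ... | s , p , q′ = s , ≤-trans p (n≤1+n r) , trans q q′

    capacity : ℕ → ℕ
    capacity m = 2 + maxWindow m (k ∸ m)

    windowSum≤capacity : ∀ s m → s + m ≤ k → 2 + windowSum e s m ≤ capacity m
    windowSum≤capacity s m p = s≤s (s≤s (windowSum≤maxWindow m (k ∸ m) s (m+n≤o⇒m≤o∸n s p)))

    capacity-attained : ∀ m → m ≤ k → ∃ λ s → s + m ≤ k × capacity m ≡ 2 + windowSum e s m
    capacity-attained m p with maxWindow-attained m (k ∸ m)
    ... | s , q , r = s , ≤-trans (+-monoˡ-≤ m q) (≤-reflexive (m∸n+n≡m p)) , cong (2 +_) r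

    n≤capacity-k : n ≤ capacity k
    n≤capacity-k = ≤-trans n≤2+Σe (windowSum≤capacity 0 k ≤-refl)

    -- Widening a best window by one spine vertex (to the right, or to the left at the end) adds ≥ 1.
    capacity-strict : ∀ m → suc m ≤ k → suc (capacity m) ≤ capacity (suc m)
    capacity-strict m p with capacity-attained m (≤-trans (n≤1+n m) p)
    ... | s , q , r with m≤n⇒m<n∨m≡n q
    ... | inj₁ lt = begin
      suc (capacity m)                     ≡⟨ cong suc r ⟩
      suc (2 + windowSum e s m)            ≤⟨ s≤s (s≤s (≤-trans (≤-reflexive (+-comm 1 _)) (+-monoʳ-≤ (windowSum e s m) (1≤e (s + m) lt)))) ⟩
      2 + (windowSum e s m + e (s + m))    ≡⟨ cong (2 +_) (sym (windowSum-snoc e s m)) ⟩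
      2 + windowSum e s (suc m)            ≤⟨ windowSum≤capacity s (suc m) (≤-trans (≤-reflexive (+-suc s m)) lt) ⟩
      capacity (suc m)                     ∎
      where open ≤-Reasoning
    ... | inj₂ s+m≡k = atEnd s s+m≡k r
      where
      atEnd : ∀ s → s + m ≡ k → capacity m ≡ 2 + windowSum e s m → suc (capacity m) ≤ capacity (suc m)
      atEnd zero m≡k _ = ⊥-elim (1+n≰n (≤-trans p (≤-reflexive (sym m≡k))))
      atEnd (suc s) s+m≡k r = begin
        suc (capacity m)                        ≡⟨ cong suc r ⟩
        suc (2 + windowSum e (suc s) m)         ≤⟨ s≤s (s≤s (+-monoˡ-≤ _ (1≤e s (≤-trans (s≤s (m≤m+n s m)) (≤-reflexive s+m≡k))))) ⟩
        2 + windowSum e s (suc m)               ≤⟨ windowSum≤capacity s (suc m) (≤-reflexive (trans (+-suc s m) s+m≡k)) ⟩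
        capacity (suc m)                        ∎
        where open ≤-Reasoning

    capacity-subadditive : ∀ p q → p + q ≤ k → capacity (p + q) + 2 ≤ capacity p + capacity q
    capacity-subadditive p q h with capacity-attained (p + q) h
    ... | s , w , r = begin
      capacity (p + q) + 2                                      ≡⟨ cong (_+ 2) (trans r (cong (2 +_) (windowSum-+ e s p q))) ⟩
      2 + (windowSum e s p + windowSum e (s + p) q) + 2          ≡⟨ rearrange (windowSum e s p) (windowSum e (s + p) q) ⟩
      (2 + windowSum e s p) + (2 + windowSum e (s + p) q)        ≤⟨ +-mono-≤ (windowSum≤capacity s p s+p≤k)
                                                                              (windowSum≤capacity (s + p) q (≤-trans (≤-reflexive (+-assoc s p q)) w)) ⟩
      capacity p + capacity q                                   ∎
      where
      open ≤-Reasoning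
      rearrange : ∀ a b → 2 + (a + b) + 2 ≡ (2 + a) + (2 + b)
      rearrange = solve-∀
      s+p≤k : s + p ≤ k
      s+p≤k = ≤-trans (m≤m+n (s + p) q) (≤-trans (≤-reflexive (+-assoc s p q)) w)

    -- μ i = least m ∈ [1, k] with i ≤ capacity m (k if there is none).
    μ : ℕ → ℕ
    μ i = suc (search (λ j → i ≤ᵇ capacity (suc j)) (k ∸ 1))

    private
      1+[k∸1]≡k : suc (k ∸ 1) ≡ k
      1+[k∸1]≡k = trans (+-comm 1 (k ∸ 1)) (m∸n+n≡m 1≤k)

    μ≤k : ∀ i → μ i ≤ k
    μ≤k i = ≤-trans (s≤s (search≤ _ (k ∸ 1))) (≤-reflexive 1+[k∸1]≡k)

    ≤capacity-μ : ∀ i → i ≤ n → i ≤ capacity (μ i)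
    ≤capacity-μ i p with m≤n⇒m<n∨m≡n (search≤ (λ j → i ≤ᵇ capacity (suc j)) (k ∸ 1))
    ... | inj₁ lt = ≤ᵇ-true⇒≤ (search-found _ (k ∸ 1) lt)
    ... | inj₂ eq = ≤-trans p (≤-trans n≤capacity-k (≤-reflexive (cong capacity (sym (trans (cong suc eq) 1+[k∸1]≡k)))))

    1≤μ : ∀ i → 1 ≤ μ i
    1≤μ i = s≤s z≤n

    μ-minimal : ∀ i m → m < μ i → 1 ≤ m → ¬ (i ≤ capacity m)
    μ-minimal i (suc j) (s≤s lt) _ = ≤ᵇ-false⇒≰ (search-minimal _ (k ∸ 1) j lt)

    μ-least : ∀ i m → 1 ≤ m → i ≤ capacity m → μ i ≤ m
    μ-least i (suc j) _ h = s≤s (search-least _ (k ∸ 1) j (≤⇒≤ᵇ-true h))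

    μ-unique : ∀ i m → 1 ≤ m → m ≤ k → i ≤ capacity m → (∀ m′ → 1 ≤ m′ → m′ < m → ¬ (i ≤ capacity m′)) → μ i ≡ m
    μ-unique i m 1≤m m≤k h below with m≤n⇒m<n∨m≡n (μ-least i m 1≤m h)
    ... | inj₂ eq = eq
    ... | inj₁ lt = ⊥-elim (below (μ i) (s≤s z≤n) lt
                      (≤ᵇ-true⇒≤ (search-found _ (k ∸ 1) (≤-pred (≤-trans lt (≤-trans m≤k (≤-reflexive (sym 1+[k∸1]≡k))))))))

    μ-mono : ∀ i i′ → i ≤ i′ → i′ ≤ n → μ i ≤ μ i′
    μ-mono i i′ p q = μ-least i (μ i′) (s≤s z≤n) (≤-trans p (≤capacity-μ i′ q))

    μ-step : ∀ i → suc i ≤ n → μ (suc i) ≤ suc (μ i)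
    μ-step i p with m≤n⇒m<n∨m≡n (μ≤k i)
    ... | inj₂ eq = ≤-trans (μ≤k (suc i)) (≤-trans (≤-reflexive (sym eq)) (n≤1+n _))
    ... | inj₁ lt = μ-least (suc i) (suc (μ i)) (s≤s z≤n)
                      (≤-trans (s≤s (≤capacity-μ i (≤-trans (n≤1+n i) p))) (capacity-strict (μ i) lt))

    μ[3+j]≤1+j : ∀ j → μ (3 + j) ≤ suc j
    μ[3+j]≤1+j j with suc j ≤? k
    ... | yes p = μ-least (3 + j) (suc j) (s≤s z≤n)
                    (≤-trans (s≤s (s≤s (m≤windowSum 0 (suc j) p))) (windowSum≤capacity 0 (suc j) p))
    ... | no np = ≤-trans (μ≤k (3 + j)) (≤-trans (≤-pred (≰⇒> np)) (n≤1+n j))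

    leafProfile : ℕ → ℕ
    leafProfile zero = 0
    leafProfile (suc zero) = 0
    leafProfile (suc (suc zero)) = 2
    leafProfile (suc (suc (suc j))) = (3 + j) ∸ μ (3 + j)

    leafProfile-3 : leafProfile 3 ≡ 2
    leafProfile-3 = cong (3 ∸_) (≤-antisym (μ[3+j]≤1+j 0) (s≤s z≤n))

    leafProfile+μ : ∀ j → leafProfile (3 + j) + μ (3 + j) ≡ 3 + j
    leafProfile+μ j = m∸n+n≡m (≤-trans (μ[3+j]≤1+j j) (≤-trans (n≤1+n _) (n≤1+n _)))

    leafProfile-step : ∀ j → 4 + j ≤ n →
      leafProfile (4 + j) ≡ leafProfile (3 + j) ⊎ leafProfile (4 + j) ≡ suc (leafProfile (3 + j))
    leafProfile-step j p with m≤n⇒m<n∨m≡n (μ-step (3 + j) p)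
    ... | inj₂ eq = inj₁ (+-cancelʳ-≡ (μ (4 + j)) _ _ (begin
          leafProfile (4 + j) + μ (4 + j)        ≡⟨ leafProfile+μ (suc j) ⟩
          suc (3 + j)                            ≡⟨ cong suc (sym (leafProfile+μ j)) ⟩
          suc (leafProfile (3 + j) + μ (3 + j))  ≡⟨ sym (+-suc _ _) ⟩
          leafProfile (3 + j) + suc (μ (3 + j))  ≡⟨ cong (leafProfile (3 + j) +_) (sym eq) ⟩
          leafProfile (3 + j) + μ (4 + j)        ∎))
      where open ≡-Reasoning
    ... | inj₁ lt = inj₂ (+-cancelʳ-≡ (μ (4 + j)) _ _ (begin
          leafProfile (4 + j) + μ (4 + j)        ≡⟨ leafProfile+μ (suc j) ⟩
          suc (3 + j)                            ≡⟨ cong suc (sym (leafProfile+μ j)) ⟩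
          suc (leafProfile (3 + j) + μ (3 + j))  ≡⟨ cong (λ x → suc (leafProfile (3 + j) + x)) μ-same ⟩
          suc (leafProfile (3 + j) + μ (4 + j))  ∎))
      where
      open ≡-Reasoning
      μ-same : μ (3 + j) ≡ μ (4 + j)
      μ-same = ≤-antisym (μ-mono (3 + j) (4 + j) (n≤1+n _) p) (≤-pred lt)

    -- Split a best window for 3 + a + l vertices after its first μ (3 + a) - 1 spine vertices:
    -- by minimality of μ (3 + a) and subadditivity of capacity, the rest holds 3 + l vertices.
    μ-superadditive : ∀ a l → 3 + a + l ≤ n → μ (3 + a) + μ (3 + l) ≤ suc (μ (3 + a + l))
    μ-superadditive a l h = bySize (μ (3 + a)) refl
      where
      M : ℕ
      M = μ (3 + a + l)
      μa≤M : μ (3 + a) ≤ M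
      μa≤M = μ-mono (3 + a) (3 + a + l) (m≤m+n _ l) h
      3+a+l≤capM : 3 + a + l ≤ capacity M
      3+a+l≤capM = ≤capacity-μ _ h
      bySize : ∀ p → μ (3 + a) ≡ p → p + μ (3 + l) ≤ suc M
      bySize zero eq with subst (1 ≤_) eq (s≤s z≤n)
      ... | ()
      bySize (suc zero) eq = s≤s (μ-least (3 + l) M (s≤s z≤n)
                          (≤-trans (s≤s (s≤s (s≤s (m≤n+m l a)))) (≤-trans (≤-reflexive (sym (+-assoc 3 a l))) 3+a+l≤capM)))
      bySize (suc (suc p′)) eq = ≤-trans (+-monoʳ-≤ (suc p) μl≤r) (≤-reflexive (cong suc (m+[n∸m]≡n p≤M)))
        where
        p = suc p′
        r = M ∸ p
        p≤M : p ≤ M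
        p≤M = ≤-trans (n≤1+n p) (≤-trans (≤-reflexive (sym eq)) μa≤M)
        1≤r : 1 ≤ r
        1≤r = m<n⇒0<n∸m (≤-trans (≤-reflexive (sym eq)) μa≤M)
        ¬a≤capp : ¬ (3 + a ≤ capacity p)
        ¬a≤capp = μ-minimal (3 + a) p (≤-reflexive (sym eq)) (s≤s z≤n)
        split : capacity M + 2 ≤ capacity p + capacity r
        split = ≤-trans (≤-reflexive (cong (λ z → capacity z + 2) (sym (m+[n∸m]≡n p≤M))))
                  (capacity-subadditive p r (≤-trans (≤-reflexive (m+[n∸m]≡n p≤M)) (μ≤k (3 + a + l))))
        l≤capr : 3 + l ≤ capacity r
        l≤capr with 3 + l ≤? capacity r
        ... | yes q = q
        ... | no ¬q = ⊥-elim (1+n≰n (begin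
              suc ((2 + a) + (2 + l))    ≡⟨ shuffle a l ⟩
              3 + a + l + 2              ≤⟨ +-monoˡ-≤ 2 3+a+l≤capM ⟩
              capacity M + 2             ≤⟨ split ⟩
              capacity p + capacity r    ≤⟨ +-mono-≤ (≤-pred (≰⇒> ¬a≤capp)) (≤-pred (≰⇒> ¬q)) ⟩
              (2 + a) + (2 + l)          ∎))
          where
          open ≤-Reasoning
          shuffle : ∀ a l → suc ((2 + a) + (2 + l)) ≡ 3 + a + l + 2
          shuffle = solve-∀
        μl≤r : μ (3 + l) ≤ r
        μl≤r = μ-least (3 + l) r 1≤r l≤capr

    leafProfile-subadditive : ∀ a l → 3 + a + l ≤ n →
      leafProfile (3 + (a + l)) + 2 ≤ leafProfile (3 + l) + leafProfile (3 + a)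
    leafProfile-subadditive a l h = +-cancelʳ-≤ (μ (3 + a) + μ (3 + l)) _ _
        (≤-trans (+-monoʳ-≤ (leafProfile (3 + (a + l)) + 2) (μ-superadditive a l h)) (≤-reflexive eqn))
      where
      open ≡-Reasoning
      eqn : leafProfile (3 + (a + l)) + 2 + suc (μ (3 + (a + l)))
          ≡ leafProfile (3 + l) + leafProfile (3 + a) + (μ (3 + a) + μ (3 + l))
      eqn = begin
        leafProfile (3 + (a + l)) + 2 + suc (μ (3 + (a + l)))    ≡⟨ shift (leafProfile (3 + (a + l))) (μ (3 + (a + l))) ⟩
        leafProfile (3 + (a + l)) + μ (3 + (a + l)) + 3          ≡⟨ cong (_+ 3) (leafProfile+μ (a + l)) ⟩
        3 + (a + l) + 3                                          ≡⟨ regroup a l ⟩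
        (3 + l) + (3 + a)                                        ≡⟨ cong₂ _+_ (sym (leafProfile+μ l)) (sym (leafProfile+μ a)) ⟩
        (leafProfile (3 + l) + μ (3 + l)) + (leafProfile (3 + a) + μ (3 + a))
                                                                 ≡⟨ interchange (leafProfile (3 + l)) (μ (3 + l)) (leafProfile (3 + a)) (μ (3 + a)) ⟩
        leafProfile (3 + l) + leafProfile (3 + a) + (μ (3 + a) + μ (3 + l)) ∎
        where
        shift : ∀ x y → x + 2 + suc y ≡ x + y + 3
        shift = solve-∀
        regroup : ∀ a l → 3 + (a + l) + 3 ≡ (3 + l) + (3 + a)
        regroup = solve-∀
        interchange : ∀ p q r s → (p + q) + (r + s) ≡ p + r + (s + q)
        interchange = solve-∀

module Intervals where

  open import Data.Nat using (ℕ; suc; _+_; _≤_; _<_; s≤s; _<?_; _≤?_)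
  open import Data.Nat.Properties
  open import Data.Product using (_×_; _,_)
  open import Data.Sum using (_⊎_; inj₁; inj₂)
  open import Data.Empty using (⊥; ⊥-elim)
  open import Relation.Nullary using (¬_; yes; no)
  open import Relation.Binary.PropositionalEquality

  Consecutive : ℕ → ℕ → Set
  Consecutive x y = suc x ≡ y ⊎ suc y ≡ x

  Consecutive-sym : ∀ {x y} → Consecutive x y → Consecutive y x
  Consecutive-sym (inj₁ e) = inj₂ e
  Consecutive-sym (inj₂ e) = inj₁ e

  InWindow : ℕ → ℕ → ℕ → Set
  InWindow s m x = s ≤ x × x < s + m

  ∈window-split : ∀ {s t m} → s ≤ t → t < s + suc m → t ≡ s ⊎ (suc s ≤ t × t < suc s + m)
  ∈window-split {s} {t} {m} s≤t t<s+1+m with m≤n⇒m<n∨m≡n s≤t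
  ... | inj₂ s≡t = inj₁ (sym s≡t)
  ... | inj₁ s<t = inj₂ (s<t , subst (t <_) (+-suc s m) t<s+1+m)

  ∉window⇒outside : ∀ s m x → ¬ InWindow s m x → x < s ⊎ s + m ≤ x
  ∉window⇒outside s m x ni with x <? s
  ... | yes p = inj₁ p
  ... | no np with s + m ≤? x
  ... | yes q = inj₂ q
  ... | no nq = ⊥-elim (ni (≮⇒≥ np , ≰⇒> nq))

  window-entry-unique : ∀ s m a t t' → ¬ InWindow s m a → InWindow s m t → InWindow s m t' →
    Consecutive a t → Consecutive a t' → t ≡ t'
  window-entry-unique s m a t t' na (st , tm) (st' , tm') p q with ∉window⇒outside s m a na
  window-entry-unique s m a t t' na (st , tm) (st' , tm') (inj₁ refl) (inj₁ refl) | _ = refl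
  window-entry-unique s m a t t' na (st , tm) (st' , tm') (inj₂ refl) (inj₂ refl) | _ = refl
  window-entry-unique s m a t t' na (st , tm) (st' , tm') (inj₁ refl) (inj₂ refl) | inj₁ as = ⊥-elim (<⇒≱ as (≤-trans st' (n≤1+n _)))
  window-entry-unique s m a t t' na (st , tm) (st' , tm') (inj₁ refl) (inj₂ refl) | inj₂ sa = ⊥-elim (<⇒≱ (≤-trans (s≤s (n≤1+n _)) tm) sa)
  window-entry-unique s m a t t' na (st , tm) (st' , tm') (inj₂ refl) (inj₁ refl) | inj₁ as = ⊥-elim (<⇒≱ as (≤-trans st (n≤1+n _)))
  window-entry-unique s m a t t' na (st , tm) (st' , tm') (inj₂ refl) (inj₁ refl) | inj₂ sa = ⊥-elim (<⇒≱ (≤-trans (s≤s (n≤1+n _)) tm') sa)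

  window-neighbours-nonadjacent : ∀ s m a b t t' → ¬ InWindow s m a → ¬ InWindow s m b → InWindow s m t → InWindow s m t' →
    Consecutive a t → Consecutive b t' → Consecutive a b → ⊥
  window-neighbours-nonadjacent s m a b t t' na nb (st , tm) (st' , tm') p q r with ∉window⇒outside s m a na | ∉window⇒outside s m b nb
  window-neighbours-nonadjacent s m a b t t' na nb (st , tm) (st' , tm') (inj₂ refl) q r | inj₁ as | _ = <⇒≱ as (≤-trans st (n≤1+n _))
  window-neighbours-nonadjacent s m a b t t' na nb (st , tm) (st' , tm') (inj₁ refl) q (inj₁ refl) | inj₁ as | _ = nb (st , tm)
  window-neighbours-nonadjacent s m a b t t' na nb (st , tm) (st' , tm') (inj₁ refl) (inj₁ refl) (inj₂ refl) | inj₁ as | _ = <⇒≱ as st'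
  window-neighbours-nonadjacent s m a b t t' na nb (st , tm) (st' , tm') (inj₁ refl) (inj₂ refl) (inj₂ refl) | inj₁ as | _ = <⇒≱ as (≤-trans st' (≤-trans (n≤1+n _) (n≤1+n _)))
  window-neighbours-nonadjacent s m a b t t' na nb (st , tm) (st' , tm') (inj₁ refl) q r | inj₂ sa | _ = <⇒≱ (≤-trans (n≤1+n _) tm) sa
  window-neighbours-nonadjacent s m a b t t' na nb (st , tm) (st' , tm') (inj₂ refl) q (inj₂ refl) | inj₂ sa | _ = nb (st , tm)
  window-neighbours-nonadjacent s m a b t t' na nb (st , tm) (st' , tm') (inj₂ refl) (inj₂ refl) (inj₁ refl) | inj₂ sa | _ = <⇒≱ tm' sa
  window-neighbours-nonadjacent s m a b t t' na nb (st , tm) (st' , tm') (inj₂ refl) (inj₁ refl) (inj₁ refl) | inj₂ sa | _ = <⇒≱ (≤-trans (≤-trans (n≤1+n _) (n≤1+n _)) tm') sa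

module CaterpillarLeaves {n : ℕ} (G : Graph n) (3≤n : 3 ≤ n) (cat : IsCaterpillar G) where

  open Counting
  open Search
  open WindowSums
  open Intervals
  open InducedSubgraphs G public
  open import Data.Nat using (ℕ; zero; suc; _+_; _∸_; _≤_; _<_; z≤n; s≤s; _≡ᵇ_; _<?_; _≤?_; _≟_)
  open import Data.Nat.Properties hiding (_≟_)
  open import Data.Bool using (Bool; true; false; _∧_; _∨_; not)
  open import Data.Fin using (Fin; zero; suc; toℕ; fromℕ<)
  import Data.Fin.Properties as FP
  open import Data.Fin.Subset using (Subset; _∈_; ∣_∣; ⊤)
  open import Data.Fin.Subset.Properties using (∈⊤; ∣⊤∣≡n)
  open import Data.Vec using (lookup; tabulate)
  open import Data.Vec.Properties using (lookup∘tabulate; lookup-replicate)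
  open import Data.Product using (Σ; ∃; _×_; _,_; proj₁; proj₂)
  open import Data.Sum using (_⊎_; inj₁; inj₂)
  import Data.Sum
  open import Data.Empty using (⊥-elim)
  open import Relation.Nullary using (¬_; yes; no)
  open import Relation.Binary.PropositionalEquality
  open import Function.Bundles using (_⇔_; Equivalence)
  open import Function.Definitions using (Injective)
  open import Data.Bool.Properties using (∨-identityʳ; ∧-zeroʳ)
  open import Data.Nat.Tactic.RingSolver using (solve-∀)

  tree : IsTree G ⊤
  tree = proj₁ cat
  connected : Connected G ⊤
  connected = proj₁ tree
  acyclic : ¬ Cycle G ⊤
  acyclic = proj₂ tree

  k : ℕ
  k = proj₁ (proj₂ cat)
  f : Fin k → Fin n
  f = proj₁ (proj₂ (proj₂ cat))
  f-injective : Injective _≡_ _≡_ f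
  f-injective = proj₁ (proj₂ (proj₂ (proj₂ cat)))
  f-spine : ∀ u → (u ∈ nonLeaves G) ⇔ (∃ λ i → f i ≡ u)
  f-spine = proj₁ (proj₂ (proj₂ (proj₂ (proj₂ cat))))
  f-adj : ∀ i j → Adj G (f i) (f j) ⇔ (suc (toℕ i) ≡ toℕ j ⊎ suc (toℕ j) ≡ toℕ i)
  f-adj = proj₂ (proj₂ (proj₂ (proj₂ (proj₂ cat))))

  v₀ : Fin n
  v₀ = fromℕ< {0} (≤-trans (s≤s z≤n) 3≤n)

  degree : Fin n → ℕ
  degree u = deg G ⊤ u

  isSpine : Fin n → Bool
  isSpine u = lookup (nonLeaves G) u

  isSpine≡ : ∀ u → isSpine u ≡ not (degree u ≡ᵇ 1)
  isSpine≡ u = lookup∘tabulate _ u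

  3≤∣⊤∣ : 3 ≤ ∣ ⊤ {n} ∣
  3≤∣⊤∣ = ≤-trans 3≤n (≤-reflexive (sym (∣⊤∣≡n n)))

  2≤∣⊤∣ : 2 ≤ ∣ ⊤ {n} ∣
  2≤∣⊤∣ = ≤-trans (n≤1+n 2) 3≤∣⊤∣

  ¬spine⇒degree≡1 : ∀ u → isSpine u ≡ false → degree u ≡ 1
  ¬spine⇒degree≡1 u e = ≡ᵇ-true⇒≡ (not-false (trans (sym (isSpine≡ u)) e))

  spine⇒2≤degree : ∀ u → isSpine u ≡ true → 2 ≤ degree u
  spine⇒2≤degree u e with has-neighbour ⊤ connected 2≤∣⊤∣ u ∈⊤
  ... | w , w∈ , u~w = 1≤d⇒d≢1⇒2≤d (deg-pos ⊤ u w w∈ u~w)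
        (λ d≡1 → t≢f (trans (sym (trans (sym (isSpine≡ u)) e)) (cong (λ d → not (d ≡ᵇ 1)) d≡1)))

  -- The t-th spine vertex for t < k, with the junk value v₀ beyond the spine.
  spine : ℕ → Fin n
  spine t with t <? k
  ... | yes p = f (fromℕ< p)
  ... | no _ = v₀

  spine≡f : ∀ {t} (p : t < k) → spine t ≡ f (fromℕ< p)
  spine≡f {t} p with t <? k
  ... | yes q = cong f (FP.fromℕ<-cong t t refl q p)
  ... | no np = ⊥-elim (np p)

  spine-toℕ : ∀ (i : Fin k) → spine (toℕ i) ≡ f i
  spine-toℕ i = trans (spine≡f (FP.toℕ<n i)) (cong f (FP.fromℕ<-toℕ i (FP.toℕ<n i)))

  spine-injective : ∀ {t t'} → t < k → t' < k → spine t ≡ spine t' → t ≡ t'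
  spine-injective {t} {t'} p p' e =
    trans (sym (FP.toℕ-fromℕ< p)) (trans (cong toℕ (f-injective (trans (sym (spine≡f p)) (trans e (spine≡f p'))))) (FP.toℕ-fromℕ< p'))

  spine-adj⇒ : ∀ {t t'} → t < k → t' < k → Adj G (spine t) (spine t') → suc t ≡ t' ⊎ suc t' ≡ t
  spine-adj⇒ {t} {t'} p p' a with Equivalence.to (f-adj (fromℕ< p) (fromℕ< p')) (subst₂ (Adj G) (spine≡f p) (spine≡f p') a)
  ... | inj₁ e = inj₁ (subst₂ (λ x y → suc x ≡ y) (FP.toℕ-fromℕ< p) (FP.toℕ-fromℕ< p') e)
  ... | inj₂ e = inj₂ (subst₂ (λ x y → suc x ≡ y) (FP.toℕ-fromℕ< p') (FP.toℕ-fromℕ< p) e)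

  spine-adj⇐ : ∀ {t t'} → t < k → t' < k → suc t ≡ t' ⊎ suc t' ≡ t → Adj G (spine t) (spine t')
  spine-adj⇐ {t} {t'} p p' c = subst₂ (Adj G) (sym (spine≡f p)) (sym (spine≡f p')) (Equivalence.from (f-adj (fromℕ< p) (fromℕ< p')) consecutive′)
    where
    consecutive′ : suc (toℕ (fromℕ< p)) ≡ toℕ (fromℕ< p') ⊎ suc (toℕ (fromℕ< p')) ≡ toℕ (fromℕ< p)
    consecutive′ = Data.Sum.map (subst₂ (λ x y → suc x ≡ y) (sym (FP.toℕ-fromℕ< p)) (sym (FP.toℕ-fromℕ< p')))
                      (subst₂ (λ x y → suc x ≡ y) (sym (FP.toℕ-fromℕ< p')) (sym (FP.toℕ-fromℕ< p))) c

  isSpine⇒spine : ∀ u → isSpine u ≡ true → ∃ λ t → t < k × spine t ≡ u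
  isSpine⇒spine u e with Equivalence.to (f-spine u) (lookup⇒∈ e)
  ... | i , fi = toℕ i , FP.toℕ<n i , trans (spine-toℕ i) fi

  spine-isSpine : ∀ {t} → t < k → isSpine (spine t) ≡ true
  spine-isSpine {t} p = ∈⇒lookup (Equivalence.from (f-spine (spine t)) (fromℕ< p , sym (spine≡f p)))

  2≤degree-spine : ∀ {t} → t < k → 2 ≤ degree (spine t)
  2≤degree-spine p = spine⇒2≤degree _ (spine-isSpine p)

  ¬spine-neighbour-isSpine : ∀ u x → isSpine u ≡ false → Adj G u x → isSpine x ≡ true
  ¬spine-neighbour-isSpine u x e a with isSpine x in ex′
  ... | true = refl
  ... | false = ⊥-elim (leaf-neighbour-not-leaf ⊤ connected 3≤∣⊤∣ u x ∈⊤ ∈⊤ a (¬spine⇒degree≡1 u e) (¬spine⇒degree≡1 x ex′))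

  1≤k : 1 ≤ k
  1≤k with isSpine v₀ in e
  ... | true with isSpine⇒spine v₀ e
  ... | t , p , _ = ≤-trans (s≤s z≤n) p
  1≤k | false with has-neighbour ⊤ connected 2≤∣⊤∣ v₀ ∈⊤
  ... | w , _ , a with isSpine⇒spine w (¬spine-neighbour-isSpine v₀ w e a)
  ... | t , p , _ = ≤-trans (s≤s z≤n) p

  ¬spine-neighbour-unique : ∀ u y y' → isSpine u ≡ false → Adj G u y → Adj G u y' → y ≡ y'
  ¬spine-neighbour-unique u y y' e a a' = deg≡1⇒neighbour-unique ⊤ u (¬spine⇒degree≡1 u e) ∈⊤ a ∈⊤ a'

  closedNbhd : Fin n → Fin n → Bool
  closedNbhd x v = (v == x) ∨ adj G x v

  window : ℕ → ℕ → Fin n → Bool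
  window s zero v = false
  window s (suc m) v = (v == spine s) ∨ window (suc s) m v

  windowNbhd : ℕ → ℕ → Fin n → Bool
  windowNbhd s zero v = false
  windowNbhd s (suc m) v = closedNbhd (spine s) v ∨ windowNbhd (suc s) m v

  e : ℕ → ℕ
  e t = degree (spine t) ∸ 1

  window⇒ : ∀ s m v → window s m v ≡ true → ∃ λ t → s ≤ t × t < s + m × v ≡ spine t
  window⇒ s (suc m) v h with ∨-e {v == spine s} h
  ... | inj₁ q = s , ≤-refl , subst (s <_) (sym (+-suc s m)) (s≤s (m≤m+n s m)) , ==⇒≡ {x = v} {y = spine s} q
  ... | inj₂ q with window⇒ (suc s) m v q
  ... | t , a , b , c = t , ≤-trans (n≤1+n s) a , subst (t <_) (sym (+-suc s m)) b , c

  ⇒window : ∀ s m t → s ≤ t → t < s + m → window s m (spine t) ≡ true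
  ⇒window s zero t p q = ⊥-elim (<⇒≱ q (subst (_≤ t) (sym (+-identityʳ s)) p))
  ⇒window s (suc m) t p q with ∈window-split {s} {t} {m} p q
  ... | inj₁ refl = ∨-l (==-refl (spine t))
  ... | inj₂ (a , b) = ∨-r {spine t == spine s} (⇒window (suc s) m t a b)

  windowNbhd⇒ : ∀ s m v → windowNbhd s m v ≡ true → ∃ λ t → s ≤ t × t < s + m × (v ≡ spine t ⊎ Adj G (spine t) v)
  windowNbhd⇒ s (suc m) v h with ∨-e {closedNbhd (spine s) v} h
  ... | inj₁ q = s , ≤-refl , subst (s <_) (sym (+-suc s m)) (s≤s (m≤m+n s m)) , closedNbhd⇒ q
    where
    closedNbhd⇒ : closedNbhd (spine s) v ≡ true → v ≡ spine s ⊎ Adj G (spine s) v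
    closedNbhd⇒ q with ∨-e {v == spine s} q
    ... | inj₁ a = inj₁ (==⇒≡ {x = v} {y = spine s} a)
    ... | inj₂ a = inj₂ a
  ... | inj₂ q with windowNbhd⇒ (suc s) m v q
  ... | t , a , b , c = t , ≤-trans (n≤1+n s) a , subst (t <_) (sym (+-suc s m)) b , c

  ⇒windowNbhd : ∀ s m t v → s ≤ t → t < s + m → (v ≡ spine t ⊎ Adj G (spine t) v) → windowNbhd s m v ≡ true
  ⇒windowNbhd s zero t v p q _ = ⊥-elim (<⇒≱ q (subst (_≤ t) (sym (+-identityʳ s)) p))
  ⇒windowNbhd s (suc m) t v p q c with ∈window-split {s} {t} {m} p q
  ... | inj₂ (a , b) = ∨-r {closedNbhd (spine s) v} (⇒windowNbhd (suc s) m t v a b c)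
  ⇒windowNbhd s (suc m) t v p q (inj₁ refl) | inj₁ refl = ∨-l (∨-l (==-refl (spine t)))
  ⇒windowNbhd s (suc m) t v p q (inj₂ a) | inj₁ refl = ∨-l (∨-r {v == spine t} a)

  window⊆windowNbhd : ∀ s m v → window s m v ≡ true → windowNbhd s m v ≡ true
  window⊆windowNbhd s m v h with window⇒ s m v h
  ... | t , a , b , c = ⇒windowNbhd s m t v a b (inj₁ c)

  count-window : ∀ s m → s + m ≤ k → count (window s m) ≡ m
  count-window s zero _ = count-false {g = window s zero} (λ _ → refl)
  count-window s (suc m) p =
    trans (count-∨-disjoint (_== spine s) (window (suc s) m) disjoint)
      (cong₂ _+_ (count-== (spine s)) (count-window (suc s) m (subst (_≤ k) (+-suc s m) p)))
    where
    disjoint : ∀ v → ((v == spine s) ∧ window (suc s) m v) ≡ false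
    disjoint v with v == spine s in e₁ | window (suc s) m v in e₂
    ... | false | _ = refl
    ... | true | false = refl
    ... | true | true with window⇒ (suc s) m v e₂
    ... | t , 1+s≤t , t<1+s+m , v≡t = ⊥-elim (1+n≰n (≤-trans 1+s≤t (≤-reflexive (sym
          (spine-injective s<k (≤-trans t<1+s+m 1+s+m≤k) (trans (sym (==⇒≡ {x = v} e₁)) v≡t))))))
      where
      1+s+m≤k : suc s + m ≤ k
      1+s+m≤k = ≤-trans (≤-reflexive (sym (+-suc s m))) p
      s<k : s < k
      s<k = ≤-trans (s≤s (m≤m+n s m)) 1+s+m≤k

  degree≡count : ∀ x → degree x ≡ count (adj G x)
  degree≡count x = trans (deg≡count ⊤ x) (count-cong (λ v → cong (_∧ adj G x v) (lookup-replicate v true)))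

  count-closedNbhd : ∀ x → count (closedNbhd x) ≡ 1 + degree x
  count-closedNbhd x =
    trans (count-∨-disjoint (_== x) (adj G x) disjoint) (cong₂ _+_ (count-== x) (sym (degree≡count x)))
    where
    disjoint : ∀ v → ((v == x) ∧ adj G x v) ≡ false
    disjoint v with v == x in e₁ | adj G x v in e₂
    ... | false | _ = refl
    ... | true | false = refl
    ... | true | true = ⊥-elim (adj-irrefl (subst (Adj G x) (==⇒≡ {x = v} e₁) e₂))

  1+degree≡2+e : ∀ {t} → t < k → 1 + degree (spine t) ≡ 2 + e t
  1+degree≡2+e {t} p = trans (cong suc (sym (m∸n+n≡m {degree (spine t)} {1} (≤-trans (s≤s z≤n) (2≤degree-spine p))))) (cong suc (+-comm (e t) 1))

  closedNbhd∩windowNbhd : ∀ s m v → 1 ≤ m → suc s + m ≤ k →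
    (closedNbhd (spine s) v ∧ windowNbhd (suc s) m v) ≡ ((v == spine s) ∨ (v == spine (suc s)))
  closedNbhd∩windowNbhd s m v m1 p = bool-ext ⇒pair pair⇒
    where
    sk : s < k
    sk = ≤-trans (s≤s (m≤m+n s m)) p
    s1k : suc s < k
    s1k = ≤-trans (≤-reflexive (sym (+-comm (suc s) 1))) (≤-trans (+-monoʳ-≤ (suc s) m1) p)
    ⇒pair : (closedNbhd (spine s) v ∧ windowNbhd (suc s) m v) ≡ true → ((v == spine s) ∨ (v == spine (suc s))) ≡ true
    ⇒pair h with ∨-e {v == spine s} (∧-l h) | windowNbhd⇒ (suc s) m v (∧-r {closedNbhd (spine s) v} h)
    ... | inj₁ q | _ = ∨-l q
    ... | inj₂ a | t , ta , tb , inj₁ refl with spine-adj⇒ sk (≤-trans tb p) a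
    ... | inj₁ refl = ∨-r {spine (suc s) == spine s} (==-refl (spine (suc s)))
    ... | inj₂ refl = ⊥-elim (1+n≰n (≤-trans (n≤1+n (suc t)) ta))
    ⇒pair h | inj₂ a | t , ta , tb , inj₂ a' with isSpine v in ev
    ... | false = ⊥-elim (1+n≰n (≤-trans ta (≤-reflexive (spine-injective (≤-trans tb p) sk
                    (¬spine-neighbour-unique v (spine t) (spine s) ev (adj-sym a') (adj-sym a))))))
    ... | true with isSpine⇒spine v ev
    ... | b , bk , refl with spine-adj⇒ sk bk a
    ... | inj₁ refl = ∨-r {spine (suc s) == spine s} (==-refl (spine (suc s)))
    ... | inj₂ refl with spine-adj⇒ (≤-trans tb p) bk a'
    ... | inj₁ refl = ⊥-elim (≤⇒≯ (≤-trans (n≤1+n _) (n≤1+n _)) ta)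
    ... | inj₂ refl = ⊥-elim (≤⇒≯ ≤-refl ta)
    s1m : suc s < suc s + m
    s1m = ≤-trans (≤-reflexive (sym (+-comm (suc s) 1))) (+-monoʳ-≤ (suc s) m1)
    pair⇒ : ((v == spine s) ∨ (v == spine (suc s))) ≡ true → (closedNbhd (spine s) v ∧ windowNbhd (suc s) m v) ≡ true
    pair⇒ h with ∨-e {v == spine s} h
    ... | inj₁ q rewrite ==⇒≡ {x = v} {y = spine s} q =
          ∧-i (∨-l (==-refl (spine s))) (⇒windowNbhd (suc s) m (suc s) (spine s) ≤-refl s1m (inj₂ (spine-adj⇐ s1k sk (inj₂ refl))))
    ... | inj₂ q rewrite ==⇒≡ {x = v} {y = spine (suc s)} q =
          ∧-i (∨-r {spine (suc s) == spine s} (spine-adj⇐ sk s1k (inj₁ refl))) (⇒windowNbhd (suc s) m (suc s) (spine (suc s)) ≤-refl s1m (inj₁ refl))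

  -- The closed neighbourhood of spine s meets that of the window starting at suc s in exactly
  -- spine s and spine (suc s), so each extra spine vertex adds (1 + degree) - 2 = e vertices.
  count-windowNbhd : ∀ s m → 1 ≤ m → s + m ≤ k → count (windowNbhd s m) ≡ 2 + windowSum e s m
  count-windowNbhd s (suc zero) _ p =
    trans (count-cong (λ v → ∨-identityʳ (closedNbhd (spine s) v)))
      (trans (count-closedNbhd (spine s)) (trans (1+degree≡2+e s<k) (cong (2 +_) (sym (+-identityʳ (e s))))))
    where
    s<k : s < k
    s<k = ≤-trans (≤-reflexive (sym (+-comm s 1))) p
  count-windowNbhd s (suc (suc m)) _ p = extend-window (count-windowNbhd (suc s) (suc m) (s≤s z≤n) (≤-trans (≤-reflexive (sym (+-suc s (suc m)))) p))
    where
    sk : s < k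
    sk = ≤-trans (s≤s (m≤m+n s (suc m))) (≤-trans (≤-reflexive (sym (+-suc s (suc m)))) p)
    p' : suc s + suc m ≤ k
    p' = ≤-trans (≤-reflexive (sym (+-suc s (suc m)))) p
    extend-window : count (windowNbhd (suc s) (suc m)) ≡ 2 + windowSum e (suc s) (suc m) → count (windowNbhd s (suc (suc m))) ≡ 2 + windowSum e s (suc (suc m))
    extend-window ih = +-cancelʳ-≡ 2 _ _ (begin
      count (windowNbhd s (suc (suc m))) + 2
        ≡⟨ cong (count (windowNbhd s (suc (suc m))) +_) (sym (trans (count-cong (λ v → closedNbhd∩windowNbhd s (suc m) v (s≤s z≤n) p'))
                                                                    (count-pair (spine s) (spine (suc s)) spine-s≢spine-1+s))) ⟩
      count (windowNbhd s (suc (suc m))) + count (λ v → closedNbhd (spine s) v ∧ windowNbhd (suc s) (suc m) v)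
        ≡⟨ count-∨ (closedNbhd (spine s)) (windowNbhd (suc s) (suc m)) ⟩
      count (closedNbhd (spine s)) + count (windowNbhd (suc s) (suc m))
        ≡⟨ cong₂ _+_ (trans (count-closedNbhd (spine s)) (1+degree≡2+e sk)) ih ⟩
      (2 + e s) + (2 + windowSum e (suc s) (suc m))
        ≡⟨ rearrange (e s) (windowSum e (suc s) (suc m)) ⟩
      2 + windowSum e s (suc (suc m)) + 2 ∎)
      where
      open ≡-Reasoning
      spine-s≢spine-1+s : spine s ≢ spine (suc s)
      spine-s≢spine-1+s eq = 1+n≰n (≤-reflexive (sym (spine-injective sk
        (≤-trans (s≤s (m≤m+n (suc s) m)) (≤-trans (≤-reflexive (sym (+-suc (suc s) m))) p')) eq)))
      rearrange : ∀ a b → (2 + a) + (2 + b) ≡ 2 + (a + b) + 2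
      rearrange = solve-∀

  windowNbhd-all : ∀ v → windowNbhd 0 k v ≡ true
  windowNbhd-all v with isSpine v in ev
  ... | true with isSpine⇒spine v ev
  ... | t , tk , refl = ⇒windowNbhd 0 k t (spine t) z≤n tk (inj₁ refl)
  windowNbhd-all v | false with has-neighbour ⊤ connected 2≤∣⊤∣ v ∈⊤
  ... | w , _ , a with isSpine⇒spine w (¬spine-neighbour-isSpine v w ev a)
  ... | t , tk , refl = ⇒windowNbhd 0 k t v z≤n tk (inj₂ (adj-sym a))

  2+Σe≡n : 2 + windowSum e 0 k ≡ n
  2+Σe≡n = trans (sym (count-windowNbhd 0 k 1≤k ≤-refl)) (trans (count-cong windowNbhd-all) count-true)

  1≤e : ∀ t → t < k → 1 ≤ e t
  1≤e t p = ∸-monoˡ-≤ 1 (2≤degree-spine p)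

  open Profile k 1≤k e 1≤e n (≤-reflexive (sym 2+Σe≡n)) public

  2≤degree⇒isSpine : ∀ u → 2 ≤ degree u → isSpine u ≡ true
  2≤degree⇒isSpine u p = trans (isSpine≡ u) (cong not (≢⇒≡ᵇ-false (λ q → 1+n≰n (≤-trans p (≤-reflexive q)))))

  internal⇒spine : ∀ S → Connected G S → 2 ≤ ∣ S ∣ → ∀ u → internal S u ≡ true → ∃ λ t → t < k × spine t ≡ u
  internal⇒spine S c s2 u iu = isSpine⇒spine u (2≤degree⇒isSpine u
    (≤-trans (internal⇒2≤deg S c s2 u iu) (deg-mono S ⊤ u (λ x _ → lookup-replicate x true))))

  internal-interval : ∀ S → Connected G S → 2 ≤ ∣ S ∣ → ∀ {x v} → Walk G (tabulate (internal S)) x v →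
    ∀ a b c → a < k → b < k → spine a ≡ x → spine b ≡ v → a ≤ c → c ≤ b → internal S (spine c) ≡ true
  internal-interval S cn s2 (here m) a b c ak bk refl eb ac cb with spine-injective ak bk (sym eb)
  ... | refl = subst (λ z → internal S (spine z) ≡ true) (≤-antisym ac cb) (∈-tabulate⁻ m)
  internal-interval S cn s2 (step {w = w} m adj p) a b c ak bk refl eb ac cb with a ≟ c
  ... | yes refl = ∈-tabulate⁻ m
  ... | no ne with internal⇒spine S cn s2 w (∈-tabulate⁻ (walk-source∈ p))
  ... | a' , a'k , refl = internal-interval S cn s2 p a' b c a'k bk refl eb (a'c (spine-adj⇒ ak a'k adj)) cb
    where
    a<c : a < c
    a<c = ≤∧≢⇒< ac ne
    a'c : suc a ≡ a' ⊎ suc a' ≡ a → a' ≤ c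
    a'c (inj₁ refl) = a<c
    a'c (inj₂ refl) = ≤-trans (n≤1+n a') ac

  has-internal : ∀ S → Connected G S → 3 ≤ ∣ S ∣ → ∃ λ u → internal S u ≡ true
  has-internal S cn 3≤∣S∣ with find (lookup S)
  ... | inj₂ none = ⊥-elim (1+n≰n (≤-trans 3≤∣S∣ (≤-trans (≤-reflexive (trans (∣S∣≡count-lookup S) (count-false none))) z≤n)))
  ... | inj₁ (u , u∈) with internal S u in iu
  ... | true = u , iu
  ... | false with has-neighbour S cn (≤-trans (n≤1+n 2) 3≤∣S∣) u (lookup⇒∈ u∈)
  ... | x , x∈ , u~x = x , ∧-i (∈⇒lookup x∈) (cong not (≢⇒≡ᵇ-false
        (leaf-neighbour-not-leaf S cn 3≤∣S∣ u x (lookup⇒∈ u∈) x∈ u~x (¬internal⇒deg≡1 S u (lookup⇒∈ u∈) iu))))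

  -- s is the first internal spine index and m the length of the run of internal ones after it;
  -- by internal-interval no internal spine vertex lies beyond that run.
  internal-is-window : ∀ S → Connected G S → 3 ≤ ∣ S ∣ →
    ∃ λ s → ∃ λ m → 1 ≤ m × s + m ≤ k × (∀ u → internal S u ≡ window s m u)
  internal-is-window S cn 3≤∣S∣ = s , m , 1≤m , s+m≤k , λ u → bool-ext (internal⇒window u) (window⇒internal u)
    where
    I : Fin n → Bool
    I = internal S
    2≤∣S∣ : 2 ≤ ∣ S ∣
    2≤∣S∣ = ≤-trans (n≤1+n 2) 3≤∣S∣
    t₀ : ∃ λ t → t < k × I (spine t) ≡ true
    t₀ with has-internal S cn 3≤∣S∣
    ... | u , iu with internal⇒spine S cn 2≤∣S∣ u iu
    ... | t , t<k , refl = t , t<k , iu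
    s : ℕ
    s = search (λ t → I (spine t)) k
    s<k : s < k
    s<k = ≤-trans (s≤s (search-least _ k (proj₁ t₀) (proj₂ (proj₂ t₀)))) (proj₁ (proj₂ t₀))
    Is : I (spine s) ≡ true
    Is = search-found _ k s<k
    m : ℕ
    m = search (λ d → not (I (spine (s + d)))) (k ∸ s)
    s+m≤k : s + m ≤ k
    s+m≤k = ≤-trans (+-monoʳ-≤ s (search≤ _ (k ∸ s))) (≤-reflexive (m+[n∸m]≡n (<⇒≤ s<k)))
    run : ∀ d → d < m → I (spine (s + d)) ≡ true
    run d d<m = not-false (search-minimal _ (k ∸ s) d d<m)
    1≤m : 1 ≤ m
    1≤m = 1≤search _ (k ∸ s) (m<n⇒0<n∸m s<k) (cong not (subst (λ z → I (spine z) ≡ true) (sym (+-identityʳ s)) Is))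
    inRun : ∀ t → t < k → I (spine t) ≡ true → s ≤ t × t < s + m
    inRun t t<k It = s≤t , t<s+m
      where
      s≤t : s ≤ t
      s≤t with s ≤? t
      ... | yes p = p
      ... | no s≰t = ⊥-elim (t≢f (trans (sym It) (search-minimal _ k t (≰⇒> s≰t))))
      t<s+m : t < s + m
      t<s+m with suc t ≤? s + m
      ... | yes p = p
      ... | no ¬p = ⊥-elim (t≢f (trans (sym runEnds) (cong not endInternal)))
        where
        s+m≤t : s + m ≤ t
        s+m≤t = ≤-pred (≰⇒> ¬p)
        m<k∸s : m < k ∸ s
        m<k∸s = m+n≤o⇒m≤o∸n (suc m) (≤-trans (≤-reflexive (trans (+-comm (suc m) s) (+-suc s m))) (≤-trans (s≤s s+m≤t) t<k))
        runEnds : not (I (spine (s + m))) ≡ true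
        runEnds = search-found _ (k ∸ s) m<k∸s
        endInternal : I (spine (s + m)) ≡ true
        endInternal = internal-interval S cn 2≤∣S∣
          (walk-internal S Is It (cn (spine s) (spine t) (lookup⇒∈ (∧-l Is)) (lookup⇒∈ (∧-l It))))
          s t (s + m) s<k t<k refl refl (m≤m+n s m) s+m≤t
    internal⇒window : ∀ u → I u ≡ true → window s m u ≡ true
    internal⇒window u Iu with internal⇒spine S cn 2≤∣S∣ u Iu
    ... | t , t<k , refl with inRun t t<k Iu
    ... | s≤t , t<s+m = ⇒window s m t s≤t t<s+m
    window⇒internal : ∀ u → window s m u ≡ true → I u ≡ true
    window⇒internal u w with window⇒ s m u w
    ... | t , s≤t , t<s+m , refl = subst (λ z → I (spine z) ≡ true) (m+[n∸m]≡n s≤t)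
          (run (t ∸ s) (+-cancelˡ-< s _ _ (≤-trans (≤-reflexive (cong suc (m+[n∸m]≡n s≤t))) t<s+m)))

  ⊆windowNbhd : ∀ S → Connected G S → 3 ≤ ∣ S ∣ → ∀ s m → (∀ u → internal S u ≡ window s m u) →
    ∀ u → lookup S u ≡ true → windowNbhd s m u ≡ true
  ⊆windowNbhd S cn 3≤∣S∣ s m I≡W u u∈ with internal S u in iu
  ... | true = window⊆windowNbhd s m u (trans (sym (I≡W u)) iu)
  ... | false with has-neighbour S cn (≤-trans (n≤1+n 2) 3≤∣S∣) u (lookup⇒∈ u∈)
  ... | x , x∈ , u~x with window⇒ s m x (trans (sym (I≡W x)) (∧-i (∈⇒lookup x∈) (cong not (≢⇒≡ᵇ-false
                           (leaf-neighbour-not-leaf S cn 3≤∣S∣ u x (lookup⇒∈ u∈) x∈ u~x (¬internal⇒deg≡1 S u (lookup⇒∈ u∈) iu))))))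
  ... | t , s≤t , t<s+m , refl = ⇒windowNbhd s m t u s≤t t<s+m (inj₂ (adj-sym u~x))

  leaves≤leafProfile[3+j] : ∀ S → Connected G S → ∀ j → ∣ S ∣ ≡ 3 + j → leaves G S ≤ leafProfile (3 + j)
  leaves≤leafProfile[3+j] S cn j ∣S∣≡ = fromWindow (internal-is-window S cn 3≤∣S∣)
    where
    3≤∣S∣ : 3 ≤ ∣ S ∣
    3≤∣S∣ = ≤-trans (s≤s (s≤s (s≤s z≤n))) (≤-reflexive (sym ∣S∣≡))
    fromWindow : (∃ λ s → ∃ λ m → 1 ≤ m × s + m ≤ k × (∀ u → internal S u ≡ window s m u)) →
      leaves G S ≤ leafProfile (3 + j)
    fromWindow (s , m , 1≤m , s+m≤k , I≡W) = ≤-trans (≤-reflexive leaves≡) (∸-monoʳ-≤ (3 + j) (μ-least (3 + j) m 1≤m fits))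
      where
      fits : 3 + j ≤ capacity m
      fits = ≤-trans (≤-reflexive (trans (sym ∣S∣≡) (∣S∣≡count-lookup S)))
               (≤-trans (count-mono (⊆windowNbhd S cn 3≤∣S∣ s m I≡W))
                 (≤-trans (≤-reflexive (count-windowNbhd s m 1≤m s+m≤k)) (windowSum≤capacity s m s+m≤k)))
      leaves≡ : leaves G S ≡ (3 + j) ∸ m
      leaves≡ = sym (trans (cong (_∸ m) (trans (sym ∣S∣≡) (∣S∣≡leaves+internal S)))
                  (trans (cong (λ z → (leaves G S + z) ∸ m) (trans (count-cong I≡W) (count-window s m s+m≤k))) (m+n∸n≡m _ m)))

  leaves≤leafProfile : ∀ S → IsTree G S → leaves G S ≤ leafProfile ∣ S ∣
  leaves≤leafProfile S isTree with ∣ S ∣ in ∣S∣≡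
  ... | zero = ≤-trans (leaves≤∣S∣ S) (≤-reflexive ∣S∣≡)
  ... | suc zero = ≤-reflexive (leaves-∣S∣≡1 S ∣S∣≡)
  ... | suc (suc zero) = ≤-trans (leaves≤∣S∣ S) (≤-reflexive ∣S∣≡)
  ... | suc (suc (suc j)) = leaves≤leafProfile[3+j] S (proj₁ isTree) j ∣S∣≡

  SubtreeWithLeaves : ℕ → ℕ → Set
  SubtreeWithLeaves i l = Σ (Subset n) λ S → ∣ S ∣ ≡ i × IsTree G S × leaves G S ≡ l

  -- A vertex u outside the window but adjacent to spine t has no other neighbour in C: a leg has
  -- degree 1, and a spine vertex just beyond the window has its other spine neighbour further out.
  outside-vertex-unique-neighbour : ∀ s m (C : Fin n → Bool) → s + m ≤ k → (∀ x → C x ≡ true → windowNbhd s m x ≡ true) →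
    ∀ u t → s ≤ t → t < s + m → window s m u ≡ false → Adj G (spine t) u →
    ∀ y → y ∈ tabulate C → Adj G u y → y ≡ spine t
  outside-vertex-unique-neighbour s m C s+m≤k C⊆N u t s≤t t<s+m u∉W t~u y y∈C u~y with isSpine u in u-spine
  ... | false = ¬spine-neighbour-unique u y (spine t) u-spine u~y (adj-sym t~u)
  ... | true with isSpine⇒spine u u-spine
  ... | a , a<k , refl = viaWindowNbhd (windowNbhd⇒ s m y (C⊆N y (∈-tabulate⁻ y∈C)))
    where
    t<k : t < k
    t<k = ≤-trans t<s+m s+m≤k
    a∉W : ¬ InWindow s m a
    a∉W (s≤a , a<s+m) = t≢f (trans (sym (⇒window s m a s≤a a<s+m)) u∉W)
    a~t : Consecutive a t
    a~t = Consecutive-sym (spine-adj⇒ t<k a<k t~u)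
    viaSpineNeighbour : ∀ t′ → s ≤ t′ → t′ < s + m → Adj G (spine t′) y → y ≡ spine t
    viaSpineNeighbour t′ s≤t′ t′<s+m t′~y with isSpine y in y-spine
    ... | false = ⊥-elim (a∉W (subst (InWindow s m)
          (spine-injective (≤-trans t′<s+m s+m≤k) a<k (¬spine-neighbour-unique y (spine t′) (spine a) y-spine (adj-sym t′~y) (adj-sym u~y)))
          (s≤t′ , t′<s+m)))
    ... | true with isSpine⇒spine y y-spine
    ... | b , b<k , refl with s ≤? b | suc b ≤? s + m
    ... | yes s≤b | yes b<s+m = cong spine (sym (window-entry-unique s m a t b a∉W (s≤t , t<s+m) (s≤b , b<s+m) a~t (spine-adj⇒ a<k b<k u~y)))
    ... | no s≰b | _ = ⊥-elim (window-neighbours-nonadjacent s m a b t t′ a∉W (λ b∈ → s≰b (proj₁ b∈)) (s≤t , t<s+m) (s≤t′ , t′<s+m)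
                         a~t (Consecutive-sym (spine-adj⇒ (≤-trans t′<s+m s+m≤k) b<k t′~y)) (spine-adj⇒ a<k b<k u~y))
    ... | yes _ | no b≮s+m = ⊥-elim (window-neighbours-nonadjacent s m a b t t′ a∉W (λ b∈ → b≮s+m (proj₂ b∈)) (s≤t , t<s+m) (s≤t′ , t′<s+m)
                         a~t (Consecutive-sym (spine-adj⇒ (≤-trans t′<s+m s+m≤k) b<k t′~y)) (spine-adj⇒ a<k b<k u~y))
    viaWindowNbhd : (∃ λ t′ → s ≤ t′ × t′ < s + m × (y ≡ spine t′ ⊎ Adj G (spine t′) y)) → y ≡ spine t
    viaWindowNbhd (t′ , s≤t′ , t′<s+m , inj₁ refl) =
      cong spine (sym (window-entry-unique s m a t t′ a∉W (s≤t , t<s+m) (s≤t′ , t′<s+m) a~t (spine-adj⇒ a<k (≤-trans t′<s+m s+m≤k) u~y)))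
    viaWindowNbhd (t′ , s≤t′ , t′<s+m , inj₂ t′~y) = viaSpineNeighbour t′ s≤t′ t′<s+m t′~y

  internal⊆window : ∀ s m (C : Fin n → Bool) → s + m ≤ k → (∀ x → window s m x ≡ true → C x ≡ true) →
    (∀ x → C x ≡ true → windowNbhd s m x ≡ true) → ∀ u → internal (tabulate C) u ≡ true → window s m u ≡ true
  internal⊆window s m C s+m≤k W⊆C C⊆N u internal-u with window s m u in u∈W
  ... | true = refl
  ... | false = ⊥-elim (t≢f (trans (sym internal-u) (¬internal (windowNbhd⇒ s m u (C⊆N u (∈-tabulate⁻ u∈C))))))
    where
    u∈C : u ∈ tabulate C
    u∈C = lookup⇒∈ (∧-l internal-u)
    ¬internal : (∃ λ t → s ≤ t × t < s + m × (u ≡ spine t ⊎ Adj G (spine t) u)) → internal (tabulate C) u ≡ false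
    ¬internal (t , s≤t , t<s+m , inj₁ refl) = ⊥-elim (t≢f (trans (sym (⇒window s m t s≤t t<s+m)) u∈W))
    ¬internal (t , s≤t , t<s+m , inj₂ t~u) =
      trans (cong (λ d → lookup (tabulate C) u ∧ not (d ≡ᵇ 1)) deg≡1) (∧-zeroʳ (lookup (tabulate C) u))
      where
      deg≡1 : deg G (tabulate C) u ≡ 1
      deg≡1 = ≤-antisym (deg≤1 (tabulate C) u (spine t) (outside-vertex-unique-neighbour s m C s+m≤k C⊆N u t s≤t t<s+m u∈W t~u))
                        (deg-pos (tabulate C) u (spine t) (∈-tabulate⁺ (W⊆C (spine t) (⇒window s m t s≤t t<s+m))) (adj-sym t~u))

  walk-along-window : ∀ s m (C : Fin n → Bool) → s + m ≤ k → (∀ x → window s m x ≡ true → C x ≡ true) →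
    ∀ d → d < m → Walk G (tabulate C) (spine s) (spine (s + d))
  walk-along-window s m C s+m≤k W⊆C zero 0<m =
    subst (λ z → Walk G (tabulate C) (spine s) (spine z)) (sym (+-identityʳ s))
      (here (∈-tabulate⁺ (W⊆C (spine s) (⇒window s m s ≤-refl (m<m+n s 0<m)))))
  walk-along-window s m C s+m≤k W⊆C (suc d) 1+d<m =
    walk-snoc (walk-along-window s m C s+m≤k W⊆C d d<m)
      (spine-adj⇐ (≤-trans (+-monoʳ-< s d<m) s+m≤k) (≤-trans (+-monoʳ-< s 1+d<m) s+m≤k) (inj₁ (sym (+-suc s d))))
      (∈-tabulate⁺ (W⊆C (spine (s + suc d)) (⇒window s m (s + suc d) (m≤m+n s _) (+-monoʳ-< s 1+d<m))))
    where
    d<m : d < m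
    d<m = ≤-trans (n≤1+n _) 1+d<m

  reach-from-window : ∀ s m (C : Fin n → Bool) → s + m ≤ k → (∀ x → window s m x ≡ true → C x ≡ true) →
    (∀ x → C x ≡ true → windowNbhd s m x ≡ true) → ∀ u → u ∈ tabulate C → Walk G (tabulate C) (spine s) u
  reach-from-window s m C s+m≤k W⊆C C⊆N u u∈C = viaWindowNbhd (windowNbhd⇒ s m u (C⊆N u (∈-tabulate⁻ u∈C)))
    where
    viaWindowNbhd : (∃ λ t → s ≤ t × t < s + m × (u ≡ spine t ⊎ Adj G (spine t) u)) → Walk G (tabulate C) (spine s) u
    viaWindowNbhd (t , s≤t , t<s+m , r) = finish r
      where
      to-t : Walk G (tabulate C) (spine s) (spine t)
      to-t = subst (λ z → Walk G (tabulate C) (spine s) (spine z)) (m+[n∸m]≡n s≤t)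
               (walk-along-window s m C s+m≤k W⊆C (t ∸ s) (+-cancelˡ-< s _ _ (≤-trans (≤-reflexive (cong suc (m+[n∸m]≡n s≤t))) t<s+m)))
      finish : u ≡ spine t ⊎ Adj G (spine t) u → Walk G (tabulate C) (spine s) u
      finish (inj₁ refl) = to-t
      finish (inj₂ t~u) = walk-snoc to-t t~u u∈C

  window-subtree : ∀ i s m (C : Fin n → Bool) → s + m ≤ k → (∀ x → window s m x ≡ true → C x ≡ true) →
    (∀ x → C x ≡ true → windowNbhd s m x ≡ true) → count C ≡ i →
    Σ (Subset n) λ S → ∣ S ∣ ≡ i × IsTree G S × i ∸ m ≤ leaves G S
  window-subtree i s m C s+m≤k W⊆C C⊆N count≡i = S , ∣S∣≡i , isTree , i∸m≤leaves
    where
    S : Subset n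
    S = tabulate C
    ∣S∣≡i : ∣ S ∣ ≡ i
    ∣S∣≡i = trans (∣tabulate∣≡count C) count≡i
    reach : ∀ u → u ∈ S → Walk G S (spine s) u
    reach = reach-from-window s m C s+m≤k W⊆C C⊆N
    isTree : IsTree G S
    isTree = (λ u v u∈ v∈ → walk-append (walk-reverse (reach u u∈)) (reach v v∈)) , acyclic-subset S acyclic
    internal≤m : count (internal S) ≤ m
    internal≤m = ≤-trans (count-mono (internal⊆window s m C s+m≤k W⊆C C⊆N)) (≤-reflexive (count-window s m s+m≤k))
    i∸m≤leaves : i ∸ m ≤ leaves G S
    i∸m≤leaves = ≤-trans (∸-monoˡ-≤ m (≤-trans (≤-reflexive (trans (sym ∣S∣≡i) (∣S∣≡leaves+internal S)))
                   (+-monoʳ-≤ (leaves G S) internal≤m))) (≤-reflexive (m+n∸n≡m _ m))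

  -- Between the best window for μ (3 + j) spine vertices and its closed neighbourhood there is a
  -- vertex set of size 3 + j; it induces a tree with at most μ (3 + j) internal vertices.
  leafProfile-attained[3+j] : ∀ j → 3 + j ≤ n → SubtreeWithLeaves (3 + j) (leafProfile (3 + j))
  leafProfile-attained[3+j] j 3+j≤n = fromWindow (capacity-attained μ₃₊ⱼ (μ≤k (3 + j)))
    where
    μ₃₊ⱼ = μ (3 + j)
    fromWindow : (∃ λ s → s + μ₃₊ⱼ ≤ k × capacity μ₃₊ⱼ ≡ 2 + windowSum e s μ₃₊ⱼ) →
      SubtreeWithLeaves (3 + j) (leafProfile (3 + j))
    fromWindow (s , s+μ≤k , cap≡) = fromSet (choose-between (window s μ₃₊ⱼ) (windowNbhd s μ₃₊ⱼ) (3 + j) (window⊆windowNbhd s μ₃₊ⱼ)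
        (≤-trans (≤-reflexive (count-window s μ₃₊ⱼ s+μ≤k)) (≤-trans (μ[3+j]≤1+j j) (≤-trans (n≤1+n _) (n≤1+n _))))
        (≤-trans (≤capacity-μ (3 + j) 3+j≤n) (≤-reflexive (trans cap≡ (sym (count-windowNbhd s μ₃₊ⱼ (1≤μ (3 + j)) s+μ≤k))))))
      where
      fromSet : (∃ λ C → (∀ x → window s μ₃₊ⱼ x ≡ true → C x ≡ true) × (∀ x → C x ≡ true → windowNbhd s μ₃₊ⱼ x ≡ true)
                         × count C ≡ 3 + j) →
        SubtreeWithLeaves (3 + j) (leafProfile (3 + j))
      fromSet (C , W⊆C , C⊆N , count≡) = exact (window-subtree (3 + j) s μ₃₊ⱼ C s+μ≤k W⊆C C⊆N count≡)
        where
        exact : (Σ (Subset n) λ S → ∣ S ∣ ≡ 3 + j × IsTree G S × 3 + j ∸ μ₃₊ⱼ ≤ leaves G S) →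
          SubtreeWithLeaves (3 + j) (leafProfile (3 + j))
        exact (S , ∣S∣≡ , isTree , lower) = S , ∣S∣≡ , isTree ,
          ≤-antisym (subst (λ z → leaves G S ≤ leafProfile z) ∣S∣≡ (leaves≤leafProfile S isTree)) lower

  leafProfile-attained : ∀ i → i ≤ n → SubtreeWithLeaves i (leafProfile i)
  leafProfile-attained zero _ =
    ∅ , ∣∅∣≡0 , (∅-connected , acyclic-subset ∅ acyclic) , n≤0⇒n≡0 (≤-trans (leaves≤∣S∣ ∅) (≤-reflexive ∣∅∣≡0))
    where
    ∅ : Subset n
    ∅ = tabulate (λ _ → false)
  leafProfile-attained (suc zero) _ =
    singleton v₀ , ∣singleton∣≡1 v₀ , (singleton-connected v₀ , acyclic-subset (singleton v₀) acyclic)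
    , leaves-∣S∣≡1 (singleton v₀) (∣singleton∣≡1 v₀)
  leafProfile-attained (suc (suc zero)) _ with has-neighbour ⊤ connected 2≤∣⊤∣ v₀ ∈⊤
  ... | y , _ , v₀~y = pair v₀ y , ∣pair∣≡2 , (pair-connected , acyclic-subset (pair v₀ y) acyclic) , leaves-pair
    where open Edge v₀~y
  leafProfile-attained (suc (suc (suc j))) 3+j≤n = leafProfile-attained[3+j] j 3+j≤n

  leafFunction≡leafProfile : ∀ i → i ≤ n → LeafFunctionIs G i (leafProfile i)
  leafFunction≡leafProfile i p = leafProfile-attained i p , (λ S sz tr → subst (λ z → leaves G S ≤ leafProfile z) sz (leaves≤leafProfile S tr))

module Words where

  open Counting using (bitValue)
  open import Data.Nat using (ℕ; zero; suc; _+_; _∸_; _≤_; _<_; z≤n; s≤s; _≤?_)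
  open import Data.Integer using (_-_) renaming (+_ to pos)
  import Data.Integer.Properties as ℤ
  open import Relation.Nullary using (yes; no)
  open import Data.Nat.Properties
  open import Data.Bool using (Bool; true; false)
  open import Data.List using (List; []; _∷_; _++_; length; map; upTo; applyUpTo; take; drop)
  open import Data.List.Properties using (∷-injective; take-[])
  open import Data.Product using (_×_; _,_; proj₁; proj₂)
  open import Data.Sum using (_⊎_; inj₁; inj₂)
  open import Relation.Binary.PropositionalEquality

  range : ℕ → ℕ → List ℕ
  range a zero = []
  range a (suc l) = a ∷ range (suc a) l

  applyUpTo≡range : ∀ (f : ℕ → ℕ) a l → (∀ x → f x ≡ a + x) → applyUpTo f l ≡ range a l
  applyUpTo≡range f a zero h = refl
  applyUpTo≡range f a (suc l) h = cong₂ _∷_ (trans (h 0) (+-identityʳ a))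
    (applyUpTo≡range (λ x → f (suc x)) (suc a) l (λ x → trans (h (suc x)) (+-suc a x)))

  upTo≡range : ∀ N → upTo N ≡ range 0 N
  upTo≡range N = applyUpTo≡range (λ x → x) 0 N (λ x → refl)

  map-cong-range : ∀ {A : Set} (g h : ℕ → A) a l → (∀ j → a ≤ j → j < a + l → g j ≡ h j) → map g (range a l) ≡ map h (range a l)
  map-cong-range g h a zero H = refl
  map-cong-range g h a (suc l) H = cong₂ _∷_ (H a ≤-refl (m<m+n a (s≤s z≤n)))
    (map-cong-range g h (suc a) l (λ j p q → H j (≤-trans (n≤1+n a) p) (≤-trans q (≤-reflexive (sym (+-suc a l))))))

  ones-cons : ∀ x xs → ones (x ∷ xs) ≡ bitValue x + ones xs
  ones-cons true xs = refl
  ones-cons false xs = refl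

  nth : List Bool → ℕ → Bool
  nth [] _ = false
  nth (x ∷ xs) zero = x
  nth (x ∷ xs) (suc j) = nth xs j

  map≡map-range⇒nth : ∀ {B : Set} (g : Bool → B) (h : ℕ → B) xs a l →
    map g xs ≡ map h (range a l) → ∀ j → j < l → g (nth xs j) ≡ h (a + j)
  map≡map-range⇒nth g h (x ∷ xs) a (suc l) eq zero _ =
    trans (proj₁ (∷-injective eq)) (cong h (sym (+-identityʳ a)))
  map≡map-range⇒nth g h (x ∷ xs) a (suc l) eq (suc j) (s≤s j<l) =
    trans (map≡map-range⇒nth g h xs (suc a) l (proj₂ (∷-injective eq)) j j<l) (cong h (sym (+-suc a j)))

  ones-take-suc : ∀ xs j → j < length xs → ones (take (suc j) xs) ≡ ones (take j xs) + bitValue (nth xs j)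
  ones-take-suc (true ∷ xs) zero _ = refl
  ones-take-suc (false ∷ xs) zero _ = refl
  ones-take-suc (true ∷ xs) (suc j) (s≤s p) = cong suc (ones-take-suc xs j p)
  ones-take-suc (false ∷ xs) (suc j) (s≤s p) = ones-take-suc xs j p

  bitℤ≡pos-bitValue : ∀ b → bitℤ b ≡ pos (bitValue b)
  bitℤ≡pos-bitValue true = refl
  bitℤ≡pos-bitValue false = refl

  pos[d+x]-pos[x]≡pos[d] : ∀ d x → pos (d + x) - pos x ≡ pos d
  pos[d+x]-pos[x]≡pos[d] d x = trans (ℤ.m-n≡m⊖n (d + x) x) (trans (ℤ.⊖-≥ (m≤n+m x d)) (cong pos (m+n∸n≡m d x)))

  pos[y]-pos[x]≡pos[d]⇒y≡x+d : ∀ y x d → pos y - pos x ≡ pos d → y ≡ x + d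
  pos[y]-pos[x]≡pos[d]⇒y≡x+d y x d eq with x ≤? y
  ... | yes x≤y = trans (sym (m+[n∸m]≡n x≤y)) (cong (x +_) (ℤ.+-injective (trans (sym (ℤ.⊖-≥ x≤y)) (trans (sym (ℤ.m-n≡m⊖n y x)) eq))))
  ... | no x≰y with trans (sym (ℤ.⊖-< (≰⇒> x≰y))) (trans (sym (ℤ.m-n≡m⊖n y x)) eq) | m<n⇒0<n∸m (≰⇒> x≰y)
  ... | neg≡pos | 0<x∸y with x ∸ y
  ... | suc _ with neg≡pos
  ... | ()

  ++≡map-range : ∀ {A : Set} (g : ℕ → A) (xs ys : List A) a l → xs ++ ys ≡ map g (range a l) →
    length xs ≤ l × xs ≡ map g (range a (length xs)) × ys ≡ map g (range (a + length xs) (l ∸ length xs))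
  ++≡map-range g [] ys a l e = z≤n , refl , trans e (cong (λ z → map g (range z l)) (sym (+-identityʳ a)))
  ++≡map-range g (x ∷ xs) ys a zero ()
  ++≡map-range g (x ∷ xs) ys a (suc l) e with ++≡map-range g xs ys (suc a) l (proj₂ (∷-injective e))
  ... | p , q , r = s≤s p , cong₂ _∷_ (proj₁ (∷-injective e)) q
                  , trans r (cong (λ z → map g (range z (l ∸ length xs))) (sym (+-suc a (length xs))))

  zeros : List Bool → ℕ
  zeros [] = 0
  zeros (true ∷ w) = zeros w
  zeros (false ∷ w) = suc (zeros w)

  ones+zeros≡length : ∀ xs → ones xs + zeros xs ≡ length xs
  ones+zeros≡length [] = refl
  ones+zeros≡length (true ∷ xs) = cong suc (ones+zeros≡length xs)
  ones+zeros≡length (false ∷ xs) = trans (+-suc _ _) (cong suc (ones+zeros≡length xs))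

  zeros-++ : ∀ xs ys → zeros (xs ++ ys) ≡ zeros xs + zeros ys
  zeros-++ [] ys = refl
  zeros-++ (true ∷ xs) ys = zeros-++ xs ys
  zeros-++ (false ∷ xs) ys = cong suc (zeros-++ xs ys)

  take-+ : ∀ {A : Set} a l (xs : List A) → take (a + l) xs ≡ take a xs ++ take l (drop a xs)
  take-+ zero l xs = refl
  take-+ (suc a) l [] = sym (take-[] l)
  take-+ (suc a) l (x ∷ xs) = cong (x ∷_) (take-+ a l xs)

  zeros-take-suc : ∀ y (xs : List Bool) → zeros (take (suc y) xs) ≡ zeros (take y xs) ⊎ zeros (take (suc y) xs) ≡ suc (zeros (take y xs))
  zeros-take-suc zero [] = inj₁ refl
  zeros-take-suc (suc y) [] = inj₁ refl
  zeros-take-suc zero (true ∷ xs) = inj₁ refl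
  zeros-take-suc zero (false ∷ xs) = inj₂ refl
  zeros-take-suc (suc y) (true ∷ xs) = zeros-take-suc y xs
  zeros-take-suc (suc y) (false ∷ xs) with zeros-take-suc y xs
  ... | inj₁ e = inj₁ (cong suc e)
  ... | inj₂ e = inj₂ (cong suc e)

-- In the word of increments of F, the factor at a of length l has F (3 + (a + l)) - F (3 + a)
-- ones and the prefix of length l has F (3 + l) - 2, so F-subadditive is prefix normality.
module DifferenceWord (N : ℕ) (F : ℕ → ℕ)
  (F-step : ∀ j → j < N → F (4 + j) ≡ F (3 + j) ⊎ F (4 + j) ≡ suc (F (3 + j)))
  (F-subadditive : ∀ a l → a + l ≤ N → F (3 + (a + l)) + 2 ≤ F (3 + l) + F (3 + a))
  (F3≡2 : F 3 ≡ 2) where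

  open Counting using (bitValue; ≡ᵇ-refl; ≢⇒≡ᵇ-false)
  open Words
  open import Data.Nat using (zero; _∸_; s≤s; _≡ᵇ_)
  open import Data.Nat.Properties
  open import Data.List using (_∷_; _++_; length; map; upTo)
  open import Data.List.Properties using (map-∘)
  open import Data.Integer using (_-_) renaming (+_ to pos)
  open import Data.Product using (_,_; proj₁; proj₂)
  open import Data.Sum using (inj₁; inj₂)
  open import Relation.Binary.PropositionalEquality

  bit : ℕ → Bool
  bit j = F (4 + j) ≡ᵇ suc (F (3 + j))

  F≡bit+F : ∀ j → j < N → F (4 + j) ≡ bitValue (bit j) + F (3 + j)
  F≡bit+F j p with F-step j p
  ... | inj₂ e rewrite e | ≡ᵇ-refl (F (3 + j)) = refl
  ... | inj₁ e rewrite e | ≢⇒≡ᵇ-false {F (3 + j)} {suc (F (3 + j))} (λ q → 1+n≰n (≤-reflexive (sym q))) = refl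

  bitℤ-bit : ∀ j → j < N → bitℤ (bit j) ≡ pos (F (4 + j)) - pos (F (3 + j))
  bitℤ-bit j p = sym (trans (cong (λ z → pos z - pos (F (3 + j))) (F≡bit+F j p))
    (trans (pos[d+x]-pos[x]≡pos[d] (bitValue (bit j)) (F (3 + j))) (sym (bitℤ≡pos-bitValue (bit j)))))

  word : List Bool
  word = map bit (range 0 N)

  ones-range : ∀ a l → a + l ≤ N → ones (map bit (range a l)) + F (3 + a) ≡ F (3 + (a + l))
  ones-range a zero _ = cong (λ z → F (3 + z)) (sym (+-identityʳ a))
  ones-range a (suc l) p = begin
      ones (bit a ∷ map bit (range (suc a) l)) + F (3 + a)
        ≡⟨ cong (_+ F (3 + a)) (ones-cons (bit a) _) ⟩
      bitValue (bit a) + ones (map bit (range (suc a) l)) + F (3 + a)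
        ≡⟨ cong (_+ F (3 + a)) (+-comm (bitValue (bit a)) _) ⟩
      ones (map bit (range (suc a) l)) + bitValue (bit a) + F (3 + a)
        ≡⟨ +-assoc (ones (map bit (range (suc a) l))) _ _ ⟩
      ones (map bit (range (suc a) l)) + (bitValue (bit a) + F (3 + a))
        ≡⟨ cong (ones (map bit (range (suc a) l)) +_) (sym (F≡bit+F a (≤-trans (s≤s (m≤m+n a l)) (≤-trans (≤-reflexive (sym (+-suc a l))) p)))) ⟩
      ones (map bit (range (suc a) l)) + F (3 + suc a)
        ≡⟨ ones-range (suc a) l (≤-trans (≤-reflexive (sym (+-suc a l))) p) ⟩
      F (3 + (suc a + l))
        ≡⟨ cong (λ z → F (3 + z)) (sym (+-suc a l)) ⟩
      F (3 + (a + suc l)) ∎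
    where open ≡-Reasoning

  word-prefixNormal : PrefixNormal word
  word-prefixNormal p f (s , ps) (a , b , afb) len = +-cancelʳ-≤ (2 + F (3 + A)) _ _
    (≤-trans (≤-reflexive lhs≡) (≤-trans (F-subadditive A l (≤-trans (≤-reflexive (cong (A +_) len)) A+|f|≤N)) (≤-reflexive rhs≡)))
    where
    A = length a
    l = length p
    r1 = ++≡map-range bit a (f ++ b) 0 N afb
    r2 = ++≡map-range bit f b (0 + A) (N ∸ A) (proj₂ (proj₂ r1))
    rp = ++≡map-range bit p s 0 N ps
    A+|f|≤N : A + length f ≤ N
    A+|f|≤N = ≤-trans (+-monoʳ-≤ A (proj₁ r2)) (≤-reflexive (m+[n∸m]≡n (proj₁ r1)))
    ones-factor : ones f + F (3 + A) ≡ F (3 + (A + l))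
    ones-factor = trans (cong (λ z → ones z + F (3 + A)) (proj₁ (proj₂ r2))) (trans (ones-range A (length f) A+|f|≤N) (cong (λ z → F (3 + (A + z))) (sym len)))
    ones-prefix : ones p + 2 ≡ F (3 + l)
    ones-prefix = trans (cong (λ z → ones z + 2) (proj₁ (proj₂ rp))) (trans (cong (ones (map bit (range 0 l)) +_) (sym F3≡2)) (ones-range 0 l (proj₁ rp)))
    lhs≡ : ones f + (2 + F (3 + A)) ≡ F (3 + (A + l)) + 2
    lhs≡ = trans (cong (ones f +_) (+-comm 2 _)) (trans (sym (+-assoc (ones f) _ 2)) (cong (_+ 2) ones-factor))
    rhs≡ : F (3 + l) + F (3 + A) ≡ ones p + (2 + F (3 + A))
    rhs≡ = trans (cong (_+ F (3 + A)) (sym ones-prefix)) (+-assoc (ones p) 2 _)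

  map-bitℤ-word : map bitℤ word ≡ map (λ j → pos (F (4 + j)) - pos (F (3 + j))) (upTo N)
  map-bitℤ-word = trans (sym (map-∘ (range 0 N)))
    (trans (map-cong-range _ _ 0 N (λ j _ q → bitℤ-bit j q)) (cong (map _) (sym (upTo≡range N))))

module PrefixZeros (w : List Bool) (pnw : PrefixNormal w) where

  open Counting using (≤ᵇ-true⇒≤; ≤⇒≤ᵇ-true)
  open Search
  open Words
  open import Data.Nat using (zero; _∸_; z≤n; s≤s; _≤ᵇ_; _≤?_; _<?_)
  open import Data.Nat.Properties
  open import Data.List using (_++_; length; take; drop)
  open import Data.List.Properties using (length-take; take-all; take++drop≡id; length-drop)
  open import Data.Product using (∃; _,_)
  open import Data.Sum using (inj₁; inj₂)
  open import Data.Empty using (⊥-elim)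
  open import Relation.Nullary using (yes; no)
  open import Relation.Binary.PropositionalEquality

  N : ℕ
  N = length w

  Z : ℕ → ℕ
  Z y = zeros (take y w)

  K : ℕ
  K = Z N

  Z-suc : ∀ y → Z (suc y) ≡ Z y ⊎ Z (suc y) ≡ suc (Z y)
  Z-suc y = zeros-take-suc y w

  Z-suc≤ : ∀ y → Z (suc y) ≤ suc (Z y)
  Z-suc≤ y with Z-suc y
  ... | inj₁ e = ≤-trans (≤-reflexive e) (n≤1+n _)
  ... | inj₂ e = ≤-reflexive e

  Z-suc≥ : ∀ y → Z y ≤ Z (suc y)
  Z-suc≥ y with Z-suc y
  ... | inj₁ e = ≤-reflexive (sym e)
  ... | inj₂ e = ≤-trans (n≤1+n _) (≤-reflexive (sym e))

  Z-mono : ∀ y y' → y ≤ y' → Z y ≤ Z y'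
  Z-mono y zero z≤n = ≤-refl
  Z-mono y (suc y') p with y ≤? y'
  ... | yes q = ≤-trans (Z-mono y y' q) (Z-suc≥ y')
  ... | no nq = ≤-reflexive (cong Z (≤-antisym p (≰⇒> nq)))

  Z≤K : ∀ y → Z y ≤ K
  Z≤K y with y ≤? N
  ... | yes p = Z-mono y N p
  ... | no np = ≤-reflexive (cong zeros (trans (take-all y w (<⇒≤ (≰⇒> np))) (sym (take-all N w ≤-refl))))

  length-take-w : ∀ y → y ≤ N → length (take y w) ≡ y
  length-take-w y p = trans (length-take y w) (m≤n⇒m⊓n≡m p)

  ones+Z≡ : ∀ y → y ≤ N → ones (take y w) + Z y ≡ y
  ones+Z≡ y p = trans (ones+zeros≡length (take y w)) (length-take-w y p)

  -- first t is the length of the shortest prefix of w with t zeros (suc N if there is none).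
  Pf : ℕ → ℕ → Bool
  Pf t y = t ≤ᵇ Z y

  first : ℕ → ℕ
  first t = search (Pf t) (suc N)

  first≤1+N : ∀ t → first t ≤ suc N
  first≤1+N t = search≤ (Pf t) (suc N)

  ≤Z⇒first≤ : ∀ t y → y ≤ N → t ≤ Z y → first t ≤ y
  ≤Z⇒first≤ t y p h = search-least (Pf t) (suc N) y (≤⇒≤ᵇ-true {t} {Z y} h)

  first≤⇒≤Z : ∀ t y → y ≤ N → first t ≤ y → t ≤ Z y
  first≤⇒≤Z t y p h = ≤-trans (≤ᵇ-true⇒≤ {t} {Z (first t)} (search-found (Pf t) (suc N) (s≤s (≤-trans h p)))) (Z-mono _ _ h)

  first0 : first 0 ≡ 0
  first0 = n≤0⇒n≡0 (≤Z⇒first≤ 0 0 z≤n z≤n)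

  first≤N : ∀ t → t ≤ K → first t ≤ N
  first≤N t p = ≤Z⇒first≤ t N ≤-refl p

  first>K : ∀ t → K < t → first t ≡ suc N
  first>K t p with m≤n⇒m<n∨m≡n (first≤1+N t)
  ... | inj₂ e = e
  ... | inj₁ lt = ⊥-elim (<⇒≱ p (≤-trans (first≤⇒≤Z t (first t) (≤-pred lt) ≤-refl) (Z≤K (first t))))

  Z-first : ∀ t → t ≤ K → Z (first t) ≡ t
  Z-first t p = ≤-antisym Z-first≤t (first≤⇒≤Z t (first t) (first≤N t p) ≤-refl)
    where
    Z-first≤t : Z (first t) ≤ t
    Z-first≤t with first t in ef
    ... | zero = z≤n
    ... | suc y with t ≤? Z y
    ... | yes q = ⊥-elim (1+n≰n (≤-trans (≤-reflexive (sym ef))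
                    (≤Z⇒first≤ t y (≤-trans (n≤1+n y) (≤-trans (≤-reflexive (sym ef)) (first≤N t p))) q)))
    ... | no nq = ≤-trans (Z-suc≤ y) (≰⇒> nq)

  first-injective : ∀ t t' → t ≤ K → t' ≤ K → first t ≡ first t' → t ≡ t'
  first-injective t t' p p' e = trans (sym (Z-first t p)) (trans (cong Z e) (Z-first t' p'))

  first-strict : ∀ t → t ≤ K → first t < first (suc t)
  first-strict t p with first t <? first (suc t)
  ... | yes q = q
  ... | no nq = ⊥-elim (1+n≰n (≤-trans (first≤⇒≤Z (suc t) (first t) (first≤N t p) (≮⇒≥ nq)) (≤-reflexive (Z-first t p))))

  first-mono : ∀ t t' → t ≤ t' → first t ≤ first t'
  first-mono t t' p with t' ≤? K
  ... | no np = ≤-trans (first≤1+N t) (≤-reflexive (sym (first>K t' (≰⇒> np))))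
  ... | yes q = ≤Z⇒first≤ t (first t') (first≤N t' q) (≤-trans p (≤-reflexive (sym (Z-first t' q))))

  1≤first : ∀ t → 1 ≤ t → 1 ≤ first t
  1≤first t p with first t in ef
  ... | suc _ = s≤s z≤n
  ... | zero = ⊥-elim (1+n≰n (≤-trans p (≤-trans (first≤⇒≤Z t 0 z≤n (≤-reflexive ef)) ≤-refl)))

  Z-before-first : ∀ t y → t ≤ K → first (suc t) ≡ suc y → Z y ≡ t
  Z-before-first t y p ef = ≤-antisym Zy≤t t≤Zy
    where
    y≤N : y ≤ N
    y≤N = ≤-pred (≤-trans (≤-reflexive (sym ef)) (first≤1+N (suc t)))
    Zy≤t : Z y ≤ t
    Zy≤t with suc t ≤? Z y
    ... | yes q = ⊥-elim (1+n≰n (≤-trans (≤-reflexive (sym ef)) (≤Z⇒first≤ (suc t) y y≤N q)))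
    ... | no nq = ≤-pred (≰⇒> nq)
    t≤Zy : t ≤ Z y
    t≤Zy = first≤⇒≤Z t y y≤N (≤-pred (≤-trans (first-strict t p) (≤-reflexive ef)))

  prefix-zeros≤factor-zeros : ∀ a ℓ → a + ℓ ≤ N → Z ℓ ≤ Z (a + ℓ) ∸ Z a
  prefix-zeros≤factor-zeros a ℓ a+ℓ≤N =
    ≤-trans prefix≤factor (≤-reflexive (sym (trans (cong (_∸ Z a) (sym zeros-split)) (m+n∸m≡n (Z a) (zeros factor)))))
    where
    prefix = take ℓ w
    factor = take ℓ (drop a w)
    ℓ≤N : ℓ ≤ N
    ℓ≤N = ≤-trans (m≤n+m ℓ a) a+ℓ≤N
    length-factor : length factor ≡ ℓ
    length-factor = trans (length-take ℓ (drop a w))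
      (m≤n⇒m⊓n≡m (≤-trans (m+n≤o⇒m≤o∸n ℓ (≤-trans (≤-reflexive (+-comm ℓ a)) a+ℓ≤N)) (≤-reflexive (sym (length-drop a w)))))
    is-prefix : ∃ λ s → prefix ++ s ≡ w
    is-prefix = drop ℓ w , take++drop≡id ℓ w
    is-factor : ∃ λ a′ → ∃ λ b → a′ ++ factor ++ b ≡ w
    is-factor = take a w , drop ℓ (drop a w) , trans (cong (take a w ++_) (take++drop≡id ℓ (drop a w))) (take++drop≡id a w)
    ones-factor≤ones-prefix : ones factor ≤ ones prefix
    ones-factor≤ones-prefix = pnw prefix factor is-prefix is-factor (trans (length-take-w ℓ ℓ≤N) (sym length-factor))
    zeros-split : Z a + zeros factor ≡ Z (a + ℓ)
    zeros-split = trans (sym (zeros-++ (take a w) factor)) (cong zeros (sym (take-+ a ℓ w)))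
    prefix≤factor : Z ℓ ≤ zeros factor
    prefix≤factor = +-cancelˡ-≤ (ones factor) _ _ (≤-trans (+-monoˡ-≤ (Z ℓ) ones-factor≤ones-prefix)
      (≤-reflexive (trans (ones+Z≡ ℓ ℓ≤N) (sym (trans (ones+zeros≡length factor) length-factor)))))

  fewer-zeros⇒shorter : ∀ a ℓ j → a + ℓ ≤ N → Z (a + ℓ) ∸ Z a < Z j → ℓ < j
  fewer-zeros⇒shorter a ℓ j a+ℓ≤N fewer with ℓ <? j
  ... | yes ℓ<j = ℓ<j
  ... | no ℓ≮j = ⊥-elim (<⇒≱ fewer (≤-trans (Z-mono j ℓ (≮⇒≥ ℓ≮j)) (prefix-zeros≤factor-zeros a ℓ a+ℓ≤N)))

module ParentTree (m : ℕ) (par : ℕ → ℕ) (par< : ∀ u → 1 ≤ u → par u < u) (par≤m : ∀ u → par u ≤ m) where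

  open Counting
  open import Data.Nat using (zero; suc; _+_; z≤n; s≤s; _≡ᵇ_)
  open import Data.Nat.Properties
  open import Data.Bool using (true; false; _∧_; _∨_)
  open import Data.Bool.Properties using (∨-comm)
  open import Data.Fin using (Fin; zero; suc; toℕ; fromℕ<)
  import Data.Fin.Properties as FP
  open import Data.Fin.Subset using (⊤)
  open import Data.Fin.Subset.Properties using (∈⊤)
  open import Data.Vec.Properties using (lookup-replicate)
  open import Data.List using ([]; _∷_; _++_)
  open import Data.List.Properties using (++-assoc)
  open import Data.List.Relation.Unary.Linked as Linked using (Linked; []; [-]; _∷_)
  open import Data.List.Relation.Unary.Unique.Propositional using (Unique)
  open import Data.List.Relation.Unary.All as A using (All)
  open import Data.List.Relation.Unary.AllPairs as AP using ()
  open import Data.Unit using () renaming (⊤ to Unit)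
  open import Relation.Binary.Definitions using (Tri; tri<; tri≈; tri>)
  open import Data.Product using (∃; _×_; _,_)
  open import Data.Sum using (_⊎_; inj₁; inj₂)
  open import Data.Empty using (⊥; ⊥-elim)
  open import Relation.Nullary using (¬_)
  open import Relation.Binary.PropositionalEquality

  nonzero : ℕ → Bool
  nonzero zero = false
  nonzero (suc _) = true

  1≤nonzero : ∀ u → nonzero u ≡ true → 1 ≤ u
  1≤nonzero (suc _) _ = s≤s z≤n

  childOf : ℕ → ℕ → Bool
  childOf u v = nonzero u ∧ (par u ≡ᵇ v)

  adjℕ : ℕ → ℕ → Bool
  adjℕ u v = childOf u v ∨ childOf v u

  adjℕ-irrefl : ∀ u → adjℕ u u ≡ false
  adjℕ-irrefl zero = refl
  adjℕ-irrefl (suc u) rewrite ≢⇒≡ᵇ-false {par (suc u)} (<⇒≢ (par< (suc u) (s≤s z≤n))) = refl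

  graph : Graph (suc m)
  graph = record
    { adj = λ x y → adjℕ (toℕ x) (toℕ y)
    ; sym = λ x y → ∨-comm (childOf (toℕ x) (toℕ y)) (childOf (toℕ y) (toℕ x))
    ; irref = λ x → adjℕ-irrefl (toℕ x)
    }

  open InducedSubgraphs graph using (walk-append; walk-reverse; adj⇒≢; adj-sym; deg≡count)

  adjℕ⇒ : ∀ u v → adjℕ u v ≡ true → (1 ≤ u × par u ≡ v) ⊎ (1 ≤ v × par v ≡ u)
  adjℕ⇒ u v e with ∨-e {childOf u v} e
  ... | inj₁ q = inj₁ (1≤nonzero u (∧-l q) , ≡ᵇ-true⇒≡ (∧-r {nonzero u} q))
  ... | inj₂ q = inj₂ (1≤nonzero v (∧-l q) , ≡ᵇ-true⇒≡ (∧-r {nonzero v} q))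

  adjℕ-par : ∀ u → 1 ≤ u → adjℕ u (par u) ≡ true
  adjℕ-par (suc u) _ = ∨-l (≡ᵇ-refl (par (suc u)))

  children : ℕ → ℕ
  children u = countℕ (λ v → childOf v u) (suc m)

  childOf-asym : ∀ u v → (childOf u v ∧ childOf v u) ≡ false
  childOf-asym u v with nonzero u in e₁ | par u ≡ᵇ v in e₂ | nonzero v in e₃ | par v ≡ᵇ u in e₄
  ... | true | true | true | true = ⊥-elim (<-asym (subst (_< u) (≡ᵇ-true⇒≡ e₂) (par< u (1≤nonzero u e₁)))
                                                  (subst (_< v) (≡ᵇ-true⇒≡ e₄) (par< v (1≤nonzero v e₃))))
  ... | false | _ | _ | _ = refl
  ... | true | false | _ | _ = refl
  ... | true | true | false | _ = refl
  ... | true | true | true | false = refl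

  deg≡parent+children : ∀ (u : Fin (suc m)) → deg graph ⊤ u ≡ bitValue (nonzero (toℕ u)) + children (toℕ u)
  deg≡parent+children u = begin
    deg graph ⊤ u
      ≡⟨ deg≡count ⊤ u ⟩
    count (λ v → lookup (⊤ {suc m}) v ∧ adjℕ (toℕ u) (toℕ v))
      ≡⟨ count-cong (λ v → cong (_∧ adjℕ (toℕ u) (toℕ v)) (lookup-replicate {n = suc m} v true)) ⟩
    count {suc m} (λ v → adjℕ (toℕ u) (toℕ v))
      ≡⟨ count-toℕ {suc m} (adjℕ (toℕ u)) ⟩
    countℕ (adjℕ (toℕ u)) (suc m)
      ≡⟨ countℕ-∨-disjoint (childOf (toℕ u)) (λ v → childOf v (toℕ u)) (suc m) (λ v _ → childOf-asym (toℕ u) v) ⟩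
    countℕ (childOf (toℕ u)) (suc m) + children (toℕ u)
      ≡⟨ cong (_+ children (toℕ u)) (parents (toℕ u)) ⟩
    bitValue (nonzero (toℕ u)) + children (toℕ u) ∎
    where
    open ≡-Reasoning
    open import Data.Vec using (lookup)
    parents : ∀ u → countℕ (childOf u) (suc m) ≡ bitValue (nonzero u)
    parents u with nonzero u
    ... | true = countℕ-≡ᵇ (par u) (suc m) (s≤s (par≤m u))
    ... | false = countℕ-false _ (suc m) (λ _ _ → refl)

  walk-to-root : ∀ bound (u : Fin (suc m)) → toℕ u < bound → Walk graph ⊤ u zero
  walk-to-root (suc bound) zero _ = here ∈⊤
  walk-to-root (suc bound) (suc u) (s≤s u<bound) =
    step ∈⊤ u~parent (walk-to-root bound parent
      (≤-trans (≤-reflexive (cong suc (FP.toℕ-fromℕ< parent<1+m))) (≤-trans (par< (suc (toℕ u)) (s≤s z≤n)) u<bound)))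
    where
    parent<1+m : par (suc (toℕ u)) < suc m
    parent<1+m = s≤s (par≤m _)
    parent : Fin (suc m)
    parent = fromℕ< parent<1+m
    u~parent : Adj graph (suc u) parent
    u~parent = subst (λ z → adjℕ (suc (toℕ u)) z ≡ true) (sym (FP.toℕ-fromℕ< parent<1+m)) (adjℕ-par (suc (toℕ u)) (s≤s z≤n))

  connected : Connected graph ⊤
  connected u v _ _ = walk-append (walk-to-root (suc m) u (FP.toℕ<n u)) (walk-reverse (walk-to-root (suc m) v (FP.toℕ<n v)))

  _<ᵥ_ : Fin (suc m) → Fin (suc m) → Set
  x <ᵥ y = toℕ x < toℕ y

  _>ᵥ_ : Fin (suc m) → Fin (suc m) → Set
  x >ᵥ y = toℕ y < toℕ x

  upward-edge⇒parent : ∀ {x y} → Adj graph x y → toℕ x < toℕ y → par (toℕ y) ≡ toℕ x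
  upward-edge⇒parent {x} {y} x~y x<y with adjℕ⇒ (toℕ x) (toℕ y) x~y
  ... | inj₁ (1≤x , par≡) = ⊥-elim (<-asym (subst (_< toℕ x) par≡ (par< (toℕ x) 1≤x)) x<y)
  ... | inj₂ (_ , par≡) = par≡

  NoBacktrack : List (Fin (suc m)) → Set
  NoBacktrack [] = Unit
  NoBacktrack (a ∷ []) = Unit
  NoBacktrack (a ∷ b ∷ []) = Unit
  NoBacktrack (a ∷ b ∷ c ∷ r) = a ≢ c × NoBacktrack (b ∷ c ∷ r)

  NoBacktrack-tail : ∀ x xs → NoBacktrack (x ∷ xs) → NoBacktrack xs
  NoBacktrack-tail x [] _ = _
  NoBacktrack-tail x (y ∷ []) _ = _
  NoBacktrack-tail x (y ∷ z ∷ r) (_ , nb) = nb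

  Unique⇒NoBacktrack : ∀ ws v → Unique ws → All (v ≢_) ws → NoBacktrack (ws ++ v ∷ [])
  Unique⇒NoBacktrack [] v _ _ = _
  Unique⇒NoBacktrack (a ∷ []) v _ _ = _
  Unique⇒NoBacktrack (a ∷ b ∷ []) v _ (v≢a A.∷ _) = (λ e → v≢a (sym e)) , _
  Unique⇒NoBacktrack (a ∷ b ∷ c ∷ r) v (a∉ AP.∷ u) (_ A.∷ v∉) = A.head (A.tail a∉) , Unique⇒NoBacktrack (b ∷ c ∷ r) v u v∉

  cycle-noBacktrack : ∀ {v x₁ x₂ ws} → All (v ≢_) (x₁ ∷ x₂ ∷ ws) → Unique (x₁ ∷ x₂ ∷ ws) →
    NoBacktrack (v ∷ x₁ ∷ x₂ ∷ ws ++ v ∷ [])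
  cycle-noBacktrack {v} {x₁} {x₂} {ws} v∉ unique = A.head (A.tail v∉) , Unique⇒NoBacktrack (x₁ ∷ x₂ ∷ ws) v unique v∉

  -- Along a walk without backtracking, once a step goes up to a child every later step does too:
  -- the only smaller neighbour of a vertex is its parent, where the walk has just come from.
  ascending-continues : ∀ x y rest → Linked (Adj graph) (x ∷ y ∷ rest) → NoBacktrack (x ∷ y ∷ rest) →
    toℕ x < toℕ y → Linked _<ᵥ_ (x ∷ y ∷ rest)
  ascending-continues x y [] (_ ∷ [-]) _ x<y = x<y ∷ [-]
  ascending-continues x y (z ∷ rest) (x~y ∷ (y~z ∷ l)) (x≢z , nb) x<y = x<y ∷ ascending-continues y z rest (y~z ∷ l) nb y<z
    where
    y<z : toℕ y < toℕ z
    y<z with adjℕ⇒ (toℕ y) (toℕ z) y~z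
    ... | inj₁ (_ , par≡) = ⊥-elim (x≢z (FP.toℕ-injective (trans (sym (upward-edge⇒parent x~y x<y)) par≡)))
    ... | inj₂ (1≤z , par≡) = subst (_< toℕ z) par≡ (par< (toℕ z) 1≤z)

  Linked-last : ∀ {R : Fin (suc m) → Fin (suc m) → Set} ys a b → Linked R (ys ++ a ∷ b ∷ []) → R a b
  Linked-last [] a b (r ∷ _) = r
  Linked-last (y ∷ []) a b (_ ∷ l) = Linked-last [] a b l
  Linked-last (y ∷ y′ ∷ ys) a b (_ ∷ l) = Linked-last (y′ ∷ ys) a b l

  Linked<-ends : ∀ ys x y → Linked _<ᵥ_ (x ∷ ys ++ y ∷ []) → toℕ x < toℕ y
  Linked<-ends [] x y (r ∷ _) = r
  Linked<-ends (z ∷ ys) x y (r ∷ l) = <-trans r (Linked<-ends ys z y l)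

  Linked>-ends : ∀ ys x y → Linked _>ᵥ_ (x ∷ ys ++ y ∷ []) → toℕ y < toℕ x
  Linked>-ends [] x y (r ∷ _) = r
  Linked>-ends (z ∷ ys) x y (r ∷ l) = <-trans (Linked>-ends ys z y l) r

  ++-∷-view : ∀ (ys : List (Fin (suc m))) a b → ∃ λ y → ∃ λ rest → ys ++ a ∷ b ∷ [] ≡ y ∷ rest
  ++-∷-view [] a b = a , b ∷ [] , refl
  ++-∷-view (y ∷ ys) a b = y , ys ++ a ∷ b ∷ [] , refl

  ∷-snoc-view : ∀ (y : Fin (suc m)) ys → ∃ λ init → ∃ λ last → y ∷ ys ≡ init ++ last ∷ []
  ∷-snoc-view y [] = [] , y , refl
  ∷-snoc-view y (z ∷ ys) with ∷-snoc-view z ys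
  ... | init , last , eq = y ∷ init , last , cong (y ∷_) eq

  descending-at-end⇒descending : ∀ ys a b → Linked (Adj graph) (ys ++ a ∷ b ∷ []) → NoBacktrack (ys ++ a ∷ b ∷ []) →
    toℕ b < toℕ a → Linked _>ᵥ_ (ys ++ a ∷ b ∷ [])
  descending-at-end⇒descending [] a b (_ ∷ [-]) _ b<a = b<a ∷ [-]
  descending-at-end⇒descending (x ∷ ys) a b l nb b<a with ++-∷-view ys a b
  ... | y , rest , eq = subst (λ z → Linked _>ᵥ_ (x ∷ z)) (sym eq)
                          (first-step (subst (λ z → Linked (Adj graph) (x ∷ z)) eq l) (subst (λ z → NoBacktrack (x ∷ z)) eq nb))
    where
    rest-descending : Linked _>ᵥ_ (ys ++ a ∷ b ∷ [])
    rest-descending = descending-at-end⇒descending ys a b (Linked.tail l) (NoBacktrack-tail x _ nb) b<a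
    first-step : Linked (Adj graph) (x ∷ y ∷ rest) → NoBacktrack (x ∷ y ∷ rest) → Linked _>ᵥ_ (x ∷ y ∷ rest)
    first-step (x~y ∷ l′) nb′ with <-cmp (toℕ x) (toℕ y)
    ... | tri< x<y _ _ = ⊥-elim (<-asym b<a (Linked-last (x ∷ ys) a b
                            (subst (λ z → Linked _<ᵥ_ (x ∷ z)) (sym eq) (ascending-continues x y rest (x~y ∷ l′) nb′ x<y))))
    ... | tri≈ _ x≡y _ = ⊥-elim (adj⇒≢ x~y (FP.toℕ-injective x≡y))
    ... | tri> _ _ y<x = y<x ∷ subst (Linked _>ᵥ_) eq rest-descending

  -- A cycle v x₁ … x_r v either starts upwards (and then rises throughout), or ends downwards into v
  -- (and then falls throughout), or leaves and re-enters v from below, making x₁ = x_r its parent.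
  acyclic : ¬ Cycle graph ⊤
  acyclic (v , (x₁ ∷ []) , s≤s () , _)
  acyclic (v , (x₁ ∷ x₂ ∷ ws) , _ , (v∉ AP.∷ unique) , _ , cycle) with <-cmp (toℕ v) (toℕ x₁)
  ... | tri< v<x₁ _ _ = <-irrefl refl (Linked<-ends (x₁ ∷ x₂ ∷ ws) v v
          (ascending-continues v x₁ (x₂ ∷ ws ++ v ∷ []) cycle (cycle-noBacktrack v∉ unique) v<x₁))
  ... | tri≈ _ v≡x₁ _ = adj⇒≢ (Linked.head cycle) (FP.toℕ-injective v≡x₁)
  ... | tri> _ _ x₁<v with ∷-snoc-view x₂ ws
  ... | init , x_r , ws≡ = lastStep (<-cmp (toℕ x_r) (toℕ v))
    where
    cycle≡ : v ∷ x₁ ∷ x₂ ∷ ws ++ v ∷ [] ≡ (v ∷ x₁ ∷ init) ++ x_r ∷ v ∷ []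
    cycle≡ = cong (λ z → v ∷ x₁ ∷ z) (trans (cong (_++ v ∷ []) ws≡) (++-assoc init (x_r ∷ []) (v ∷ [])))
    cycle′ : Linked (Adj graph) ((v ∷ x₁ ∷ init) ++ x_r ∷ v ∷ [])
    cycle′ = subst (Linked (Adj graph)) cycle≡ cycle
    All-last : ∀ {P : Fin (suc m) → Set} xs y → All P (xs ++ y ∷ []) → P y
    All-last [] y (p A.∷ _) = p
    All-last (x ∷ xs) y (_ A.∷ ps) = All-last xs y ps
    x₁≢x_r : x₁ ≢ x_r
    x₁≢x_r = All-last init x_r (subst (All (x₁ ≢_)) ws≡ (AP.head unique))
    lastStep : Tri (toℕ x_r < toℕ v) (toℕ x_r ≡ toℕ v) (toℕ v < toℕ x_r) → ⊥
    lastStep (tri> _ _ v<x_r) = <-irrefl refl (Linked>-ends (x₁ ∷ x₂ ∷ ws) v v (subst (Linked _>ᵥ_) (sym cycle≡)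
      (descending-at-end⇒descending (v ∷ x₁ ∷ init) x_r v cycle′ (subst NoBacktrack cycle≡ (cycle-noBacktrack v∉ unique)) v<x_r)))
    lastStep (tri≈ _ x_r≡v _) = adj⇒≢ (Linked-last (v ∷ x₁ ∷ init) x_r v cycle′) (FP.toℕ-injective x_r≡v)
    lastStep (tri< x_r<v _ _) = x₁≢x_r (FP.toℕ-injective (trans (sym (upward-edge⇒parent (adj-sym {v} {x₁} (Linked.head cycle)) x₁<v))
                                                               (upward-edge⇒parent (Linked-last (v ∷ x₁ ∷ init) x_r v cycle′) x_r<v)))

module Construction (w : List Bool) (pnw : PrefixNormal w) where

  open Counting
  open PrefixZeros w pnw
  open import Data.Nat using (zero; suc; _+_; _∸_; z≤n; s≤s; _≡ᵇ_; _≤ᵇ_; _<ᵇ_; _≤?_)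
  open import Data.Nat.Properties
  open import Data.Bool using (true; _∧_; not)
  open import Data.Fin using (Fin; toℕ; fromℕ<)
  import Data.Fin.Properties as FP
  open import Data.Fin.Subset using (_∈_; ⊤)
  open import Data.Vec using (lookup)
  open import Data.Vec.Properties using (lookup∘tabulate)
  open import Data.Product using (∃; _,_)
  open import Data.Sum using (_⊎_; inj₁; inj₂)
  open import Data.Empty using (⊥-elim)
  open import Relation.Nullary using (yes; no)
  open import Relation.Binary.PropositionalEquality
  open import Function.Bundles using (_⇔_; mk⇔)

  n : ℕ
  n = suc (suc (suc N))

  -- Vertex y + 2 (for a position y ≤ N of w) is attached to spine vertex 1 + first (Z y); the
  -- spine is 1 + first 0, …, 1 + first K, so spine vertex j has first (j + 1) - first j ≥ 1 children.
  par : ℕ → ℕ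
  par zero = 0
  par (suc zero) = 0
  par (suc (suc y)) = suc (first (Z y))

  first≤y : ∀ y → first (Z y) ≤ y
  first≤y y with y ≤? N
  ... | yes p = ≤Z⇒first≤ (Z y) y p ≤-refl
  ... | no np = ≤-trans (first≤1+N (Z y)) (≰⇒> np)

  par< : ∀ u → 1 ≤ u → par u < u
  par< (suc zero) _ = s≤s z≤n
  par< (suc (suc y)) _ = s≤s (s≤s (first≤y y))

  par≤1+N : ∀ u → par u ≤ suc N
  par≤1+N zero = z≤n
  par≤1+N (suc zero) = z≤n
  par≤1+N (suc (suc y)) = s≤s (first≤N (Z y) (Z≤K y))

  open ParentTree (suc (suc N)) par par< (λ u → ≤-trans (par≤1+N u) (n≤1+n _)) public

  spineVertex : ℕ → ℕ
  spineVertex j = suc (first j)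

  k : ℕ
  k = suc K

  spineVertex<n : ∀ j → j ≤ K → spineVertex j < n
  spineVertex<n j p = s≤s (s≤s (≤-trans (first≤N j p) (n≤1+n N)))

  par-spineVertex₀ : par (spineVertex 0) ≡ 0
  par-spineVertex₀ = cong (λ z → par (suc z)) first0

  par-spineVertex : ∀ t → suc t ≤ K → par (spineVertex (suc t)) ≡ spineVertex t
  par-spineVertex t p = viaFirst (first (suc t)) refl
    where
    viaFirst : ∀ q → first (suc t) ≡ q → par (spineVertex (suc t)) ≡ spineVertex t
    viaFirst zero e = ⊥-elim (1+n≰n (≤-trans (1≤first (suc t) (s≤s z≤n)) (≤-reflexive e)))
    viaFirst (suc y) e = trans (cong (λ z → par (suc z)) e) (cong (λ z → suc (first z)) (Z-before-first t y (≤-trans (n≤1+n t) p) e))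

  spineVertex-injective : ∀ i j → i ≤ K → j ≤ K → spineVertex i ≡ spineVertex j → i ≡ j
  spineVertex-injective i j p q e = first-injective i j p q (suc-injective e)

  parent⇒predecessor : ∀ i j → i ≤ K → j ≤ K → par (spineVertex i) ≡ spineVertex j → suc j ≡ i
  parent⇒predecessor zero j p q r = ⊥-elim (0≢1+n (trans (sym par-spineVertex₀) r))
  parent⇒predecessor (suc i) j p q r =
    cong suc (spineVertex-injective j i q (≤-trans (n≤1+n i) p) (sym (trans (sym (par-spineVertex i p)) r)))

  parent-edge : ∀ i → suc i ≤ K → childOf (spineVertex (suc i)) (spineVertex i) ≡ true
  parent-edge i 1+i≤K = subst (λ z → (z ≡ᵇ spineVertex i) ≡ true) (sym (par-spineVertex i 1+i≤K)) (≡ᵇ-refl (spineVertex i))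

  spineVertex-adj⇐ : ∀ i j → i ≤ K → j ≤ K → (suc i ≡ j ⊎ suc j ≡ i) → adjℕ (spineVertex i) (spineVertex j) ≡ true
  spineVertex-adj⇐ i j p q (inj₁ refl) = ∨-r {childOf (spineVertex i) (spineVertex (suc i))} (parent-edge i q)
  spineVertex-adj⇐ i j p q (inj₂ refl) = ∨-l (parent-edge j p)

  spineVertex-adj⇒ : ∀ i j → i ≤ K → j ≤ K → adjℕ (spineVertex i) (spineVertex j) ≡ true → suc i ≡ j ⊎ suc j ≡ i
  spineVertex-adj⇒ i j p q e with adjℕ⇒ (spineVertex i) (spineVertex j) e
  ... | inj₁ (_ , r) = inj₂ (parent⇒predecessor i j p q r)
  ... | inj₂ (_ , r) = inj₁ (parent⇒predecessor j i q p r)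

  childCount : ℕ → ℕ
  childCount u = countℕ (λ y → suc (first (Z y)) ≡ᵇ u) (suc N)

  degree≡1+childCount : ∀ (u : Fin n) → deg graph ⊤ u ≡ 1 + childCount (toℕ u)
  degree≡1+childCount u = trans (deg≡parent+children u) (parent+children (toℕ u))
    where
    parent+children : ∀ u → bitValue (nonzero u) + children u ≡ 1 + childCount u
    parent+children zero = refl
    parent+children (suc u) = refl

  childCount-spineVertex : ∀ j → j ≤ K → childCount (spineVertex j) ≡ first (suc j) ∸ first j
  childCount-spineVertex j p =
    trans (countℕ-cong (λ y → first (Z y) ≡ᵇ first j) (λ y → (first j ≤ᵇ y) ∧ (y <ᵇ first (suc j))) (suc N)
                       (λ y y<1+N → parent≡⇔inInterval y (≤-pred y<1+N)))
      (countℕ-interval (first j) (first (suc j)) (suc N) (first-mono j (suc j) (n≤1+n j)) (first≤1+N (suc j)))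
    where
    parent≡⇔inInterval : ∀ y → y ≤ N → (first (Z y) ≡ᵇ first j) ≡ ((first j ≤ᵇ y) ∧ (y <ᵇ first (suc j)))
    parent≡⇔inInterval y yN = bool-ext ⇒inInterval inInterval⇒
      where
      ⇒inInterval : (first (Z y) ≡ᵇ first j) ≡ true → ((first j ≤ᵇ y) ∧ (y <ᵇ first (suc j))) ≡ true
      ⇒inInterval e with first-injective (Z y) j (Z≤K y) p (≡ᵇ-true⇒≡ e)
      ... | zj = ∧-i (≤⇒≤ᵇ-true {first j} {y} (≤Z⇒first≤ j y yN (≤-reflexive (sym zj)))) (≤⇒≤ᵇ-true {suc y} {first (suc j)} lt)
        where
        lt : y < first (suc j)
        lt with suc y ≤? first (suc j)
        ... | yes q = q
        ... | no nq = ⊥-elim (1+n≰n (≤-trans (first≤⇒≤Z (suc j) y yN (≤-pred (≰⇒> nq))) (≤-reflexive zj)))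
      inInterval⇒ : ((first j ≤ᵇ y) ∧ (y <ᵇ first (suc j))) ≡ true → (first (Z y) ≡ᵇ first j) ≡ true
      inInterval⇒ e = subst (λ z → (first z ≡ᵇ first j) ≡ true) (sym zj) (≡ᵇ-refl (first j))
        where
        a : j ≤ Z y
        a = first≤⇒≤Z j y yN (≤ᵇ-true⇒≤ {first j} {y} (∧-l e))
        b : Z y ≤ j
        b with suc j ≤? Z y
        ... | yes q = ⊥-elim (<⇒≱ (≤ᵇ-true⇒≤ {suc y} {first (suc j)} (∧-r {first j ≤ᵇ y} e)) (≤Z⇒first≤ (suc j) y yN q))
        ... | no nq = ≤-pred (≰⇒> nq)
        zj : Z y ≡ j
        zj = ≤-antisym b a

  childCount-off-spine : ∀ u → (∀ j → j ≤ K → spineVertex j ≢ u) → childCount u ≡ 0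
  childCount-off-spine u h = countℕ-false _ (suc N) (λ y _ → ≢⇒≡ᵇ-false (h (Z y) (Z≤K y)))

  1≤first-gap : ∀ j → j ≤ K → 1 ≤ first (suc j) ∸ first j
  1≤first-gap j p = m<n⇒0<n∸m (first-strict j p)

  f : Fin k → Fin n
  f i = fromℕ< (spineVertex<n (toℕ i) (≤-pred (FP.toℕ<n i)))

  toℕ-f : ∀ i → toℕ (f i) ≡ spineVertex (toℕ i)
  toℕ-f i = FP.toℕ-fromℕ< (spineVertex<n (toℕ i) (≤-pred (FP.toℕ<n i)))

  f-injective : ∀ {i j} → f i ≡ f j → i ≡ j
  f-injective {i} {j} e = FP.toℕ-injective (spineVertex-injective (toℕ i) (toℕ j) (≤-pred (FP.toℕ<n i)) (≤-pred (FP.toℕ<n j))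
    (trans (sym (toℕ-f i)) (trans (cong toℕ e) (toℕ-f j))))

  lookup-nonLeaves : ∀ u → lookup (nonLeaves graph) u ≡ not (deg graph ⊤ u ≡ᵇ 1)
  lookup-nonLeaves u = lookup∘tabulate (λ v → not (deg graph ⊤ v ≡ᵇ 1)) u

  f-spine : ∀ u → (u ∈ nonLeaves graph) ⇔ (∃ λ i → f i ≡ u)
  f-spine u = mk⇔ to from
    where
    to : u ∈ nonLeaves graph → ∃ λ i → f i ≡ u
    to u∈ with find (λ i → f i == u)
    ... | inj₁ (i , e) = i , ==⇒≡ {x = f i} e
    ... | inj₂ none = ⊥-elim (t≢f (trans (sym (∈⇒lookup u∈)) (trans (lookup-nonLeaves u)
                        (cong (λ d → not (d ≡ᵇ 1)) (trans (degree≡1+childCount u) (cong suc no-children))))))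
      where
      off-spine : ∀ j → j ≤ K → spineVertex j ≢ toℕ u
      off-spine j j≤K eq = t≢f (trans (sym (subst (λ z → (z ≡ᵇ toℕ u) ≡ true) (sym toℕ-fi≡u) (≡ᵇ-refl (toℕ u)))) (none i))
        where
        i = fromℕ< (s≤s j≤K)
        toℕ-fi≡u : toℕ (f i) ≡ toℕ u
        toℕ-fi≡u = trans (toℕ-f i) (trans (cong spineVertex (FP.toℕ-fromℕ< (s≤s j≤K))) eq)
      no-children : childCount (toℕ u) ≡ 0
      no-children = childCount-off-spine (toℕ u) off-spine
    from : (∃ λ i → f i ≡ u) → u ∈ nonLeaves graph
    from (i , refl) = lookup⇒∈ (trans (lookup-nonLeaves (f i))
      (trans (cong (λ d → not (d ≡ᵇ 1)) (trans (degree≡1+childCount (f i)) (cong (λ z → suc (childCount z)) (toℕ-f i))))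
        (2≤suc (≤-trans (1≤first-gap (toℕ i) i≤K) (≤-reflexive (sym (childCount-spineVertex (toℕ i) i≤K)))))))
      where
      i≤K : toℕ i ≤ K
      i≤K = ≤-pred (FP.toℕ<n i)
      2≤suc : ∀ {c} → 1 ≤ c → not (suc c ≡ᵇ 1) ≡ true
      2≤suc {suc c} _ = refl

  f-adj : ∀ i j → Adj graph (f i) (f j) ⇔ (suc (toℕ i) ≡ toℕ j ⊎ suc (toℕ j) ≡ toℕ i)
  f-adj i j = mk⇔ (λ a → spineVertex-adj⇒ (toℕ i) (toℕ j) iK jK (subst₂ (λ x y → adjℕ x y ≡ true) (toℕ-f i) (toℕ-f j) a))
                 (λ c → subst₂ (λ x y → adjℕ x y ≡ true) (sym (toℕ-f i)) (sym (toℕ-f j)) (spineVertex-adj⇐ (toℕ i) (toℕ j) iK jK c))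
    where
    iK = ≤-pred (FP.toℕ<n i)
    jK = ≤-pred (FP.toℕ<n j)

  isCaterpillar : IsCaterpillar graph
  isCaterpillar = (connected , acyclic) , k , f , f-injective , f-spine , f-adj

module LeafFunctionValues where

  open import Data.Nat using (_<?_)
  open import Data.Nat.Properties using (≤-antisym; ≤-trans; ≤-reflexive)
  open import Data.Fin using (fromℕ<)
  import Data.Fin.Properties as FP
  open import Data.Product using (_,_)
  open import Data.Empty using (⊥-elim)
  open import Relation.Nullary using (yes; no)
  open import Relation.Binary.PropositionalEquality

  leafFunction-unique : ∀ {n} (G : Graph n) i a b → LeafFunctionIs G i a → LeafFunctionIs G i b → a ≡ b
  leafFunction-unique G i a b ((S , |S| , tree , lv) , max) ((S′ , |S′| , tree′ , lv′) , max′) =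
    ≤-antisym (≤-trans (≤-reflexive (sym lv)) (max′ S |S| tree)) (≤-trans (≤-reflexive (sym lv′)) (max S′ |S′| tree′))

  at-fromℕ< : ∀ {n} (L : Fin (suc n) → ℕ) j (p : j < suc n) → at L j ≡ L (fromℕ< p)
  at-fromℕ< {n} L j p with j <? suc n
  ... | yes q = cong L (FP.fromℕ<-cong j j refl q p)
  ... | no ¬p = ⊥-elim (¬p p)

  at-toℕ : ∀ {n} (L : Fin (suc n) → ℕ) (i : Fin (suc n)) → at L (toℕ i) ≡ L i
  at-toℕ L i = trans (at-fromℕ< L (toℕ i) (FP.toℕ<n i)) (cong L (FP.fromℕ<-toℕ i (FP.toℕ<n i)))

IsCaterpillarWithLeafFunction : ∀ n → (Fin (suc n) → ℕ) → Set
IsCaterpillarWithLeafFunction n L =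
  Σ (Graph n) λ C → IsCaterpillar C × (∀ (i : Fin (suc n)) → LeafFunctionIs C (toℕ i) (L i))

module Forward {n : ℕ} (3≤n : 3 ≤ n) (L : Fin (suc n) → ℕ) (C : Graph n) (cat : IsCaterpillar C)
               (isLeafFunction : ∀ (i : Fin (suc n)) → LeafFunctionIs C (toℕ i) (L i)) where

  open LeafFunctionValues
  open Words
  open CaterpillarLeaves C 3≤n cat
  open import Data.Nat using (_∸_; s≤s)
  open import Data.Nat.Properties
  open import Data.Fin using (fromℕ<)
  import Data.Fin.Properties as FP
  open import Data.Integer using (_-_) renaming (+_ to pos)
  open import Relation.Binary.PropositionalEquality

  at≡leafProfile : ∀ j → j ≤ n → at L j ≡ leafProfile j
  at≡leafProfile j j≤n = begin
    at L j                ≡⟨ at-fromℕ< L j (s≤s j≤n) ⟩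
    L i                   ≡⟨ leafFunction-unique C (toℕ i) _ _ (isLeafFunction i) (leafFunction≡leafProfile (toℕ i) (≤-pred (FP.toℕ<n i))) ⟩
    leafProfile (toℕ i)   ≡⟨ cong leafProfile (FP.toℕ-fromℕ< (s≤s j≤n)) ⟩
    leafProfile j         ∎
    where
    open ≡-Reasoning
    i = fromℕ< (s≤s j≤n)

  N : ℕ
  N = n ∸ 3

  3+N≡n : 3 + N ≡ n
  3+N≡n = m+[n∸m]≡n 3≤n

  module W = DifferenceWord N leafProfile
    (λ j j<N → leafProfile-step j (≤-trans (s≤s (s≤s (s≤s j<N))) (≤-reflexive 3+N≡n)))
    (λ a l a+l≤N → leafProfile-subadditive a l (≤-trans (≤-reflexive (+-assoc 3 a l)) (≤-trans (+-monoʳ-≤ 3 a+l≤N) (≤-reflexive 3+N≡n))))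
    leafProfile-3

  ΔL-prefixNormal : IsPrefixNormalℤ (ΔL n L)
  ΔL-prefixNormal = W.word , map-bitℤ≡ΔL , W.word-prefixNormal
    where
    same-differences : ∀ j → 0 ≤ j → j < 0 + N →
      pos (leafProfile (4 + j)) - pos (leafProfile (3 + j)) ≡ pos (at L (j + 4)) - pos (at L (j + 3))
    same-differences j _ j<N = sym (cong₂ (λ x y → pos x - pos y)
      (trans (at≡leafProfile (j + 4) (≤-trans (≤-reflexive (+-comm j 4)) (≤-trans (s≤s (s≤s (s≤s j<N))) (≤-reflexive 3+N≡n))))
             (cong leafProfile (+-comm j 4)))
      (trans (at≡leafProfile (j + 3) (≤-trans (≤-reflexive (+-comm j 3)) (≤-trans (+-monoʳ-≤ 3 (<⇒≤ j<N)) (≤-reflexive 3+N≡n))))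
             (cong leafProfile (+-comm j 3))))
    map-bitℤ≡ΔL : map bitℤ W.word ≡ ΔL n L
    map-bitℤ≡ΔL = trans W.map-bitℤ-word (trans (cong (map _) (upTo≡range N))
      (trans (map-cong-range _ _ 0 N same-differences) (cong (map _) (sym (upTo≡range N)))))

module Backward (w : List Bool) (pnw : PrefixNormal w) (L : Fin (suc (suc (suc (suc (length w))))) → ℕ)
                (L0 : at L 0 ≡ 0) (L1 : at L 1 ≡ 0) (L2 : at L 2 ≡ 2) (L3 : at L 3 ≡ 2)
                (w≡ΔL : map bitℤ w ≡ ΔL (suc (suc (suc (length w)))) L) where

  open Counting using (bitValue)
  open LeafFunctionValues
  open Words
  open WindowSums using (windowSum)
  open PrefixZeros w pnw
  open Construction w pnw using (graph; isCaterpillar; degree≡1+childCount; childCount; childCount-spineVertex; spineVertex; toℕ-f; f)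
  open import Data.Nat using (zero; _∸_; z≤n; s≤s; _≤?_)
  open import Data.Nat.Properties
  open import Data.Fin using (fromℕ<)
  import Data.Fin.Properties as FP
  open import Data.Fin.Subset using (⊤)
  open import Data.List using (map; upTo; take)
  open import Data.Integer using (_-_) renaming (+_ to pos)
  open import Data.Product using (∃; _×_; _,_)
  open import Data.Empty using (⊥)
  open import Relation.Nullary using (¬_; yes; no)
  open import Relation.Binary.PropositionalEquality

  3≤n : 3 ≤ suc (suc (suc N))
  3≤n = s≤s (s≤s (s≤s z≤n))

  module Cat = CaterpillarLeaves graph 3≤n isCaterpillar

  e≡ : ∀ t → t < suc K → Cat.e t ≡ first (suc t) ∸ first t
  e≡ t t<1+K = begin
    deg graph ⊤ (Cat.spine t) ∸ 1        ≡⟨ cong (λ x → deg graph ⊤ x ∸ 1) (Cat.spine≡f t<1+K) ⟩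
    deg graph ⊤ (f (fromℕ< t<1+K)) ∸ 1   ≡⟨ cong (_∸ 1) (degree≡1+childCount (f (fromℕ< t<1+K))) ⟩
    childCount (toℕ (f (fromℕ< t<1+K)))          ≡⟨ cong childCount (trans (toℕ-f (fromℕ< t<1+K)) (cong spineVertex (FP.toℕ-fromℕ< t<1+K))) ⟩
    childCount (spineVertex t)                            ≡⟨ childCount-spineVertex t (≤-pred t<1+K) ⟩
    first (suc t) ∸ first t              ∎
    where open ≡-Reasoning

  windowSum≡ : ∀ s m → s + m ≤ suc K → windowSum Cat.e s m ≡ first (s + m) ∸ first s
  windowSum≡ s zero _ = trans (sym (n∸n≡0 (first s))) (cong (λ z → first z ∸ first s) (sym (+-identityʳ s)))
  windowSum≡ s (suc m) p = begin
    Cat.e s + windowSum Cat.e (suc s) m                  ≡⟨ cong₂ _+_ (e≡ s s<1+K) (windowSum≡ (suc s) m p′) ⟩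
    (first (suc s) ∸ first s) + (first (suc s + m) ∸ first (suc s))
                                                         ≡⟨ telescope (first-mono s (suc s) (n≤1+n s)) (first-mono (suc s) (suc s + m) (m≤m+n (suc s) m)) ⟩
    first (suc s + m) ∸ first s                          ≡⟨ cong (λ z → first z ∸ first s) (sym (+-suc s m)) ⟩
    first (s + suc m) ∸ first s                          ∎
    where
    open ≡-Reasoning
    p′ : suc s + m ≤ suc K
    p′ = ≤-trans (≤-reflexive (sym (+-suc s m))) p
    s<1+K : s < suc K
    s<1+K = ≤-trans (s≤s (m≤m+n s m)) p′
    telescope : ∀ {a b c} → a ≤ b → b ≤ c → (b ∸ a) + (c ∸ b) ≡ c ∸ a
    telescope {a} {b} {c} a≤b b≤c = +-cancelʳ-≡ a _ _ (begin
      (b ∸ a) + (c ∸ b) + a   ≡⟨ +-assoc (b ∸ a) (c ∸ b) a ⟩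
      (b ∸ a) + ((c ∸ b) + a) ≡⟨ cong ((b ∸ a) +_) (+-comm (c ∸ b) a) ⟩
      (b ∸ a) + (a + (c ∸ b)) ≡⟨ sym (+-assoc (b ∸ a) a (c ∸ b)) ⟩
      (b ∸ a) + a + (c ∸ b)   ≡⟨ cong (_+ (c ∸ b)) (m∸n+n≡m a≤b) ⟩
      b + (c ∸ b)             ≡⟨ m+[n∸m]≡n b≤c ⟩
      c                       ≡⟨ sym (m∸n+n≡m (≤-trans a≤b b≤c)) ⟩
      c ∸ a + a               ∎)

  -- A window of m ≤ Z j spine vertices spans a factor of w with fewer than m zeros before its last
  -- letter, so by prefix normality that factor is no longer than j.
  windowSpan≤ : ∀ s m j (E : ℕ) → j ≤ N → 1 ≤ m → m ≤ Z j → first (s + m) ≡ E → E ∸ first s ≤ j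
  windowSpan≤ s m j zero _ _ _ _ = ≤-trans (≤-reflexive (0∸n≡0 (first s))) z≤n
  windowSpan≤ s m j (suc E) j≤N 1≤m m≤Zj first≡ with first s ≤? E
  ... | no fs≰E = ≤-trans (≤-reflexive (m≤n⇒m∸n≡0 (≰⇒> fs≰E))) z≤n
  ... | yes fs≤E = ≤-trans (≤-reflexive (+-∸-assoc 1 fs≤E))
                     (fewer-zeros⇒shorter (first s) (E ∸ first s) j (≤-trans (≤-reflexive fs+ℓ≡E) E≤N) fewer)
    where
    fs+ℓ≡E : first s + (E ∸ first s) ≡ E
    fs+ℓ≡E = m+[n∸m]≡n fs≤E
    E≤N : E ≤ N
    E≤N = ≤-pred (≤-trans (≤-reflexive (sym first≡)) (first≤1+N (s + m)))
    ZE<s+m : suc (Z E) ≤ s + m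
    ZE<s+m = ≮⇒≥ (λ lt → 1+n≰n (≤-trans (≤-reflexive (sym first≡)) (≤Z⇒first≤ (s + m) E E≤N (≤-pred lt))))
    s≤Zfs : s ≤ Z (first s)
    s≤Zfs = first≤⇒≤Z s (first s) (≤-trans fs≤E E≤N) ≤-refl
    difference<m : ∀ x y → x < s + m → s ≤ y → x ∸ y < m
    difference<m x y x<s+m s≤y with x ≤? s
    ... | yes x≤s = ≤-trans (s≤s (≤-reflexive (m≤n⇒m∸n≡0 (≤-trans x≤s s≤y)))) 1≤m
    ... | no x≰s = ≤-trans (s≤s (∸-monoʳ-≤ x s≤y)) (+-cancelˡ-≤ s _ _
                     (≤-trans (≤-reflexive (+-suc s (x ∸ s))) (≤-trans (s≤s (≤-reflexive (m+[n∸m]≡n (<⇒≤ (≰⇒> x≰s))))) x<s+m)))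
    fewer : Z (first s + (E ∸ first s)) ∸ Z (first s) < Z j
    fewer = ≤-trans (difference<m _ _ (subst (λ z → Z z < s + m) (sym fs+ℓ≡E) ZE<s+m) s≤Zfs) m≤Zj

  μ≡1+Z : ∀ j → j ≤ N → Cat.μ (3 + j) ≡ suc (Z j)
  μ≡1+Z j j≤N = Cat.μ-unique (3 + j) (suc (Z j)) (s≤s z≤n) (s≤s (Z≤K j)) fits tooSmall
    where
    j<first : suc j ≤ first (suc (Z j))
    j<first = ≮⇒≥ (λ lt → 1+n≰n (first≤⇒≤Z (suc (Z j)) j j≤N (≤-pred lt)))
    fits : 3 + j ≤ Cat.capacity (suc (Z j))
    fits = ≤-trans (s≤s (s≤s j<first))
      (≤-trans (≤-reflexive (cong (2 +_) (sym (trans (windowSum≡ 0 (suc (Z j)) (s≤s (Z≤K j))) (cong (first (suc (Z j)) ∸_) first0)))))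
        (Cat.windowSum≤capacity 0 (suc (Z j)) (s≤s (Z≤K j))))
    tooSmall : ∀ m → 1 ≤ m → m < suc (Z j) → ¬ (3 + j ≤ Cat.capacity m)
    tooSmall m 1≤m m<1+Zj fits′ = noBestWindow (Cat.capacity-attained m (≤-trans (≤-pred m<1+Zj) (≤-trans (Z≤K j) (n≤1+n K))))
      where
      noBestWindow : (∃ λ s → s + m ≤ suc K × Cat.capacity m ≡ 2 + windowSum Cat.e s m) → ⊥
      noBestWindow (s , s+m≤k , cap≡) = 1+n≰n (≤-trans fits′ (≤-trans (≤-reflexive cap≡) (s≤s (s≤s
        (≤-trans (≤-reflexive (windowSum≡ s m s+m≤k)) (windowSpan≤ s m j (first (s + m)) j≤N 1≤m (≤-pred m<1+Zj) refl))))))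

  leafProfile≡2+ones : ∀ j → j ≤ N → Cat.leafProfile (3 + j) ≡ 2 + ones (take j w)
  leafProfile≡2+ones j j≤N = begin
    (3 + j) ∸ Cat.μ (3 + j)                 ≡⟨ cong ((3 + j) ∸_) (μ≡1+Z j j≤N) ⟩
    (3 + j) ∸ suc (Z j)                     ≡⟨ +-∸-assoc 2 Zj≤j ⟩
    2 + (j ∸ Z j)                           ≡⟨ cong (λ x → 2 + (x ∸ Z j)) (sym (ones+Z≡ j j≤N)) ⟩
    2 + (ones (take j w) + Z j ∸ Z j)       ≡⟨ cong (2 +_) (m+n∸n≡m _ (Z j)) ⟩
    2 + ones (take j w)                     ∎
    where
    open ≡-Reasoning
    Zj≤j : Z j ≤ j
    Zj≤j = ≤-trans (m≤n+m (Z j) _) (≤-reflexive (ones+Z≡ j j≤N))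

  at≡2+ones : ∀ j → j ≤ N → at L (3 + j) ≡ 2 + ones (take j w)
  at≡2+ones zero _ = L3
  at≡2+ones (suc j) j<N = begin
    at L (3 + suc j)                          ≡⟨ cong (at L) (+-comm 4 j) ⟩
    at L (j + 4)                              ≡⟨ pos[y]-pos[x]≡pos[d]⇒y≡x+d _ _ _ (trans (sym letter-j) (bitℤ≡pos-bitValue (nth w j))) ⟩
    at L (j + 3) + bitValue (nth w j)         ≡⟨ cong (_+ bitValue (nth w j)) (trans (cong (at L) (+-comm j 3)) (at≡2+ones j (≤-trans (n≤1+n j) j<N))) ⟩
    2 + ones (take j w) + bitValue (nth w j)  ≡⟨ +-assoc 2 (ones (take j w)) _ ⟩
    2 + (ones (take j w) + bitValue (nth w j)) ≡⟨ cong (2 +_) (sym (ones-take-suc w j j<N)) ⟩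
    2 + ones (take (suc j) w)                 ∎
    where
    open ≡-Reasoning
    letter-j : bitℤ (nth w j) ≡ pos (at L (j + 4)) - pos (at L (j + 3))
    letter-j = map≡map-range⇒nth bitℤ (λ j → pos (at L (j + 4)) - pos (at L (j + 3))) w 0 N
                 (trans w≡ΔL (cong (map _) (upTo≡range N))) j j<N

  at≡leafProfile : ∀ j → j ≤ suc (suc (suc N)) → at L j ≡ Cat.leafProfile j
  at≡leafProfile zero _ = L0
  at≡leafProfile (suc zero) _ = L1
  at≡leafProfile (suc (suc zero)) _ = L2
  at≡leafProfile (suc (suc (suc j))) (s≤s (s≤s (s≤s j≤N))) = trans (at≡2+ones j j≤N) (sym (leafProfile≡2+ones j j≤N))

  caterpillar : IsCaterpillarWithLeafFunction (suc (suc (suc N))) L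
  caterpillar = graph , isCaterpillar , λ i →
    subst (LeafFunctionIs graph (toℕ i)) (trans (sym (at≡leafProfile (toℕ i) (≤-pred (FP.toℕ<n i)))) (at-toℕ L i))
      (Cat.leafFunction≡leafProfile (toℕ i) (≤-pred (FP.toℕ<n i)))

caterpillar⇒ΔL-prefixNormal : ∀ n → 3 ≤ n → (L : Fin (suc n) → ℕ) →
  IsCaterpillarWithLeafFunction n L → IsPrefixNormalℤ (ΔL n L)
caterpillar⇒ΔL-prefixNormal n 3≤n L (C , cat , isLeafFunction) = Forward.ΔL-prefixNormal 3≤n L C cat isLeafFunction

ΔL-prefixNormal⇒caterpillar : ∀ n → 3 ≤ n → (L : Fin (suc n) → ℕ) →
  at L 0 ≡ 0 → at L 1 ≡ 0 → at L 2 ≡ 2 → at L 3 ≡ 2 →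
  IsPrefixNormalℤ (ΔL n L) → IsCaterpillarWithLeafFunction n L
ΔL-prefixNormal⇒caterpillar n 3≤n L L0 L1 L2 L3 (w , w≡ΔL , pnw) = byLength n n≡ L L0 L1 L2 L3 w≡ΔL
  where
  open import Data.Nat using (_∸_)
  open import Data.Nat.Properties using (m+[n∸m]≡n)
  open import Data.List using (upTo)
  open import Data.List.Properties using (length-map; length-upTo)
  open import Relation.Binary.PropositionalEquality
  n≡ : n ≡ suc (suc (suc (length w)))
  n≡ = trans (sym (m+[n∸m]≡n 3≤n)) (cong (3 +_) (sym (begin
    length w                         ≡⟨ sym (length-map bitℤ w) ⟩
    length (map bitℤ w)              ≡⟨ cong length w≡ΔL ⟩
    length (ΔL n L)                  ≡⟨ length-map _ (upTo (n ∸ 3)) ⟩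
    length (upTo (n ∸ 3))            ≡⟨ length-upTo (n ∸ 3) ⟩
    n ∸ 3                            ∎)))
    where open ≡-Reasoning
  byLength : ∀ n → n ≡ suc (suc (suc (length w))) → (L : Fin (suc n) → ℕ) →
    at L 0 ≡ 0 → at L 1 ≡ 0 → at L 2 ≡ 2 → at L 3 ≡ 2 → map bitℤ w ≡ ΔL n L → IsCaterpillarWithLeafFunction n L
  byLength _ refl L L0 L1 L2 L3 w≡ΔL = Backward.caterpillar w pnw L L0 L1 L2 L3 w≡ΔL

theorem1 : (n : ℕ) → 3 ≤ n → (L : Fin (suc n) → ℕ)
    → at L 0 ≡ 0 → at L 1 ≡ 0 → at L 2 ≡ 2 → at L 3 ≡ 2
    → (Σ (Graph n) λ C → IsCaterpillar C × (∀ (i : Fin (suc n)) → LeafFunctionIs C (toℕ i) (L i)))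
    ⇔ IsPrefixNormalℤ (ΔL n L)
theorem1 n 3≤n L L0 L1 L2 L3 =
  mk⇔ (caterpillar⇒ΔL-prefixNormal n 3≤n L) (ΔL-prefixNormal⇒caterpillar n 3≤n L L0 L1 L2 L3)
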